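{- We have $$ \lVert \eta_q^* \rVert_q^2 = \frac{1}{2} \left( \varphi(q) + c_{q_1/(q_1,q')}(N)\, c_{(q_1,q') q_2^2}(N-a') \right), $$ $$ \lVert \kappa_q^* \rVert_q^2 = \frac{1}{2} \left( \varphi(q) - c_{q_1/(q_1,q')}(N)\, c_{(q_1,q') q_2^2}(N-a') \right), $$ and $$ [\eta_q^* | \kappa_q^*]_q = [\kappa_q^* | \eta_q^*]_q = 0. $$
   Context: Let $N$ be a positive integer, and let $a',q'$ be positive integers with $(a',q')=1$. Let $q$ be a positive cubefree integer, written $q=q_1q_2^2$ with $\mu^2(q_1q_2)=1$. Here $\varphi$ is Euler's totient function, $\mu$ the Möbius function, and $c_r(k)=\sum_{1\le b\le r,\,(b,r)=1} \exp(2\pi i kb/r)$ is the Ramanujan sum. Set $t(q)=\prod_{p\mid q} \frac{ -1}{p^2-1}$. For functions $f,g$ on $\mathbb{Z}/q\mathbb{Z}$ the local Hermitian product is $[f|g]_q = \frac{1}{q}\sum_{n \bmod q} f(n)\overline{g(n)}$, with $\lVert f\rVert_q^2=[f|f]_q$. Define, for $a \in \mathbb{Z}/q\mathbb{Z}$, $$ \vartheta_q^*(a) = \frac{6\,t(q)}{\pi^2}\, c_q(N-a) $$ (this is $\gamma_q^*(N-a)$, where $\gamma_q^*=\sum_{d\mid q}\mu(q/d)\gamma_d$ is the Möbius transform of the local density $\gamma_d$ of square-free integers in residue classes modulo $d$), and $$ \widetilde{\rho_q^*}(a) = \frac{\mu(q_1/(q_1,q'))\, c_{q_1/(q_1,q')}(a)\,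 c_{(q_1,q')q_2^2}(a-a')}{\varphi(q')\,\varphi(q_1/(q_1,q'))}. $$ Then define $$ \eta_q^* = \frac{1}{2}\left( \frac{\pi^2}{6 t(q)} \vartheta_q^* + \frac{\varphi(q')\,\varphi(q_1/(q_1,q'))}{\mu(q_1/(q_1,q'))}\, \widetilde{\rho_q^*} \right), \qquad \kappa_q^* = \frac{1}{2}\left( \frac{\pi^2}{6 t(q)} \vartheta_q^* - \frac{\varphi(q')\,\varphi(q_1/(q_1,q'))}{\mu(q_1/(q_1,q'))}\, \widetilde{\rho_q^*} \right). $$ -}

module Defs where

open import Data.Nat as ℕ using (ℕ; zero; suc)
open import Data.Nat.DivMod as ND using ()
open import Data.Nat.Divisibility using (_∣?_)
open import Data.Nat.GCD using (gcd)
open import Data.Nat.Primality using (prime?)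
open import Data.Integer as ℤ using (ℤ; +_; ∣_∣)
open import Data.Rational as ℚ using (ℚ; ½)
open import Data.List using (List; map; filter; length; upTo; foldr)
open import Relation.Nullary.Decidable using (_×-dec_)
open import Data.Nat using (_≟_)

-- total natural-number quotient (m / 0 := 0); only used with nonzero divisors
_div_ : ℕ → ℕ → ℕ
m div zero = zero
m div suc n = ND._/_ m (suc n)

oneTo : ℕ → List ℕ
oneTo n = map suc (upTo n)

sumℤ : List ℤ → ℤ
sumℤ = foldr ℤ._+_ (+ 0)

prodℤ : List ℤ → ℤ
prodℤ = foldr ℤ._*_ (+ 1)

sumℚ : List ℚ → ℚ
sumℚ = foldr ℚ._+_ ℚ.0ℚ

φ : ℕ → ℕ
φ n = length (filter (λ b → gcd b n ≟ 1) (oneTo n))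

μ : ℕ → ℤ
μ n = prodℤ (map f (filter (λ p → prime? p ×-dec (p ∣? n)) (oneTo n)))
  where
  f : ℕ → ℤ
  f p with (p ℕ.* p) ∣? n
  ... | Relation.Nullary.Decidable.yes _ = + 0
  ... | Relation.Nullary.Decidable.no _ = ℤ.- (+ 1)

-- Ramanujan sum c_r(k) (integer-valued), via the von Sterneck/Hölder
-- evaluation  c_r(k) = Σ_{d ∣ gcd(r,k)} μ(r/d) d
c : ℕ → ℤ → ℤ
c r k = sumℤ (map (λ d → μ (r div d) ℤ.* (+ d))
                  (filter (λ d → (d ∣? r) ×-dec (d ∣? ∣ k ∣)) (oneTo r)))

ℤtoℚ : ℤ → ℚ
ℤtoℚ z = z ℚ./ 1

-- 1/n as a rational (with 1/0 := 0; only used for n ≥ 1)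
inv : ℕ → ℚ
inv zero = ℚ.0ℚ
inv (suc n) = (+ 1) ℚ./ suc n

-- local Hermitian product [f|g]_q = (1/q) Σ_{n mod q} f(n) conj(g(n));
-- all functions involved are rational-valued, so conj is the identity
herm : ℕ → (ℤ → ℚ) → (ℤ → ℚ) → ℚ
herm q f g = inv q ℚ.* sumℚ (map (λ n → f (+ n) ℚ.* g (+ n)) (upTo q))

normSq : ℕ → (ℤ → ℚ) → ℚ
normSq q f = herm q f f

module _ (N a' q' q₁ q₂ : ℕ) where
  qq : ℕ
  qq = q₁ ℕ.* (q₂ ℕ.* q₂)

  m₁ : ℕ
  m₁ = q₁ div gcd q₁ q'

  m₂ : ℕ
  m₂ = gcd q₁ q' ℕ.* (q₂ ℕ.* q₂)

  -- (π² / (6 t(q))) ϑ*_q(a) = c_q(N - a)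
  scaledϑ : ℤ → ℚ
  scaledϑ a = ℤtoℚ (c qq (+ N ℤ.- a))

  -- (φ(q') φ(m₁) / μ(m₁)) ρ̃*_q(a) = c_{m₁}(a) c_{m₂}(a - a')
  scaledρ : ℤ → ℚ
  scaledρ a = ℤtoℚ (c m₁ a ℤ.* c m₂ (a ℤ.- + a'))

  η* : ℤ → ℚ
  η* a = ½ ℚ.* (scaledϑ a ℚ.+ scaledρ a)

  κ* : ℤ → ℚ
  κ* a = ½ ℚ.* (scaledϑ a ℚ.- scaledρ a)

{-# OPTIONS --safe #-}

-- Write θ(n) = c_q(N - n) and ρ(n) = c_{q₁/(q₁,q')}(n) c_{(q₁,q')q₂²}(n - a'); then η* = (θ + ρ)/2
-- and κ* = (θ - ρ)/2. Since q₁q₂ is squarefree the two moduli are coprime with product q, so by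
-- multiplicativity of Ramanujan sums and the Chinese remainder theorem ρ(n) = c_q(n - t) for a
-- suitable t. Everything then follows from the orthogonality relation
-- Σ_{n mod q} c_q(x - n) c_q(n - y) = q c_q(x - y), proved from c_q(k) = Σ_{d ∣ (q,k)} μ(q/d) d by
-- counting solutions of pairs of congruences, together with c_q(0) = φ(q).
module Submission where

module FiniteSums where

  open import Data.Nat as ℕ using (ℕ; zero; suc; z≤n; s≤s)
  import Data.Nat.Properties as ℕP
  open import Data.Integer using (ℤ; +_; 0ℤ; 1ℤ; _+_; _*_)
  import Data.Integer.Properties as ℤP
  open import Data.Integer.Tactic.RingSolver using (solve-∀)
  open import Data.List using ([]; _∷_; map; filter; applyUpTo; upTo; length)
  open import Data.Product using (_,_)
  open import Function using (_∘_; id)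
  open import Relation.Binary.PropositionalEquality
  open import Relation.Nullary using (Dec; yes; no; ¬_; does)
  open import Data.Bool using (if_then_else_)
  open import Relation.Unary using (Pred; Decidable)
  open import Data.Empty using (⊥-elim)
  open import Defs using (sumℤ; prodℤ; oneTo)
  open import Data.List.Properties using (map-∘; map-applyUpTo)
  open import Relation.Nullary.Decidable using (_×-dec_)

  ⟦_⟧ : ∀ {a} {P : Set a} → Dec P → ℤ
  ⟦ yes _ ⟧ = 1ℤ
  ⟦ no _ ⟧ = 0ℤ

  ⟦⟧-yes : ∀ {a} {P : Set a} (P? : Dec P) → P → ⟦ P? ⟧ ≡ 1ℤ
  ⟦⟧-yes (yes _) _ = refl
  ⟦⟧-yes (no ¬p) p = ⊥-elim (¬p p)

  ⟦⟧-no : ∀ {a} {P : Set a} (P? : Dec P) → ¬ P → ⟦ P? ⟧ ≡ 0ℤ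
  ⟦⟧-no (yes p) ¬p = ⊥-elim (¬p p)
  ⟦⟧-no (no _) _ = refl

  ⟦⟧-* : ∀ {a} {P : Set a} (P? : Dec P) {u v : ℤ} → (P → u ≡ v) → ⟦ P? ⟧ * u ≡ ⟦ P? ⟧ * v
  ⟦⟧-* (yes p) u≡v = cong (1ℤ *_) (u≡v p)
  ⟦⟧-* (no _) {u} {v} _ = trans (ℤP.*-zeroˡ u) (sym (ℤP.*-zeroˡ v))

  ⟦⟧-*-zero : ∀ {a} {P : Set a} (P? : Dec P) {u : ℤ} → (P → u ≡ 0ℤ) → ⟦ P? ⟧ * u ≡ 0ℤ
  ⟦⟧-*-zero P? {u} u≡0 = trans (⟦⟧-* P? u≡0) (ℤP.*-zeroʳ ⟦ P? ⟧)

  ⟦⟧-cong : ∀ {a b} {P : Set a} {Q : Set b} (P? : Dec P) (Q? : Dec Q) → (P → Q) → (Q → P) → ⟦ P? ⟧ ≡ ⟦ Q? ⟧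
  ⟦⟧-cong (yes _) (yes _) _ _ = refl
  ⟦⟧-cong (no _) (no _) _ _ = refl
  ⟦⟧-cong (yes p) (no ¬q) P⇒Q _ = ⊥-elim (¬q (P⇒Q p))
  ⟦⟧-cong (no ¬p) (yes q) _ Q⇒P = ⊥-elim (¬p (Q⇒P q))

  ⟦⟧-×-dec : ∀ {a b} {P : Set a} {Q : Set b} (P? : Dec P) (Q? : Dec Q) → ⟦ P? ×-dec Q? ⟧ ≡ ⟦ P? ⟧ * ⟦ Q? ⟧
  ⟦⟧-×-dec (yes _) (yes _) = refl
  ⟦⟧-×-dec (yes _) (no _) = refl
  ⟦⟧-×-dec (no _) (yes _) = refl
  ⟦⟧-×-dec (no _) (no _) = refl

  ∑ : ℕ → (ℕ → ℤ) → ℤ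
  ∑ zero f = 0ℤ
  ∑ (suc n) f = f 0 + ∑ n (f ∘ suc)

  ∏ : ℕ → (ℕ → ℤ) → ℤ
  ∏ zero f = 1ℤ
  ∏ (suc n) f = f 0 * ∏ n (f ∘ suc)

  ∑-cong-< : ∀ n {f g} → (∀ i → i ℕ.< n → f i ≡ g i) → ∑ n f ≡ ∑ n g
  ∑-cong-< zero f≡g = refl
  ∑-cong-< (suc n) f≡g = cong₂ _+_ (f≡g 0 (s≤s z≤n)) (∑-cong-< n (λ i i<n → f≡g (suc i) (s≤s i<n)))

  ∑-cong : ∀ n {f g} → (∀ i → f i ≡ g i) → ∑ n f ≡ ∑ n g
  ∑-cong n f≡g = ∑-cong-< n (λ i _ → f≡g i)

  ∑-zero : ∀ n {f} → (∀ i → i ℕ.< n → f i ≡ 0ℤ) → ∑ n f ≡ 0ℤ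
  ∑-zero zero f≡0 = refl
  ∑-zero (suc n) f≡0 = cong₂ _+_ (f≡0 0 (s≤s z≤n)) (∑-zero n (λ i i<n → f≡0 (suc i) (s≤s i<n)))

  ∑-distrib-+ : ∀ n f g → ∑ n (λ i → f i + g i) ≡ ∑ n f + ∑ n g
  ∑-distrib-+ zero f g = refl
  ∑-distrib-+ (suc n) f g =
    trans (cong (_+_ (f 0 + g 0)) (∑-distrib-+ n (f ∘ suc) (g ∘ suc))) (interchange (f 0) (g 0) _ _)
    where
    interchange : ∀ a b c d → (a + b) + (c + d) ≡ (a + c) + (b + d)
    interchange = solve-∀

  ∑-*ˡ : ∀ n k f → ∑ n (λ i → k * f i) ≡ k * ∑ n f
  ∑-*ˡ zero k f = sym (ℤP.*-zeroʳ k)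
  ∑-*ˡ (suc n) k f = trans (cong (_+_ (k * f 0)) (∑-*ˡ n k (f ∘ suc))) (sym (ℤP.*-distribˡ-+ k (f 0) _))

  ∑-*ʳ : ∀ n k f → ∑ n (λ i → f i * k) ≡ ∑ n f * k
  ∑-*ʳ n k f = trans (∑-cong n (λ i → ℤP.*-comm (f i) k)) (trans (∑-*ˡ n k f) (ℤP.*-comm k _))

  ∑-comm : ∀ m n (f : ℕ → ℕ → ℤ) → ∑ m (λ i → ∑ n (f i)) ≡ ∑ n (λ j → ∑ m (λ i → f i j))
  ∑-comm zero n f = sym (∑-zero n (λ _ _ → refl))
  ∑-comm (suc m) n f =
    trans (cong (_+_ (∑ n (f 0))) (∑-comm m n (f ∘ suc))) (sym (∑-distrib-+ n (f 0) _))

  ∑*∑ : ∀ m n f g → ∑ m f * ∑ n g ≡ ∑ m (λ i → ∑ n (λ j → f i * g j))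
  ∑*∑ m n f g = trans (sym (∑-*ʳ m (∑ n g) f)) (∑-cong m (λ i → sym (∑-*ˡ n (f i) g)))

  ∑-single : ∀ n f z → z ℕ.< n → (∀ i → i ℕ.< n → i ≢ z → f i ≡ 0ℤ) → ∑ n f ≡ f z
  ∑-single (suc n) f zero _ f≡0 =
    trans (cong (_+_ (f 0)) (∑-zero n (λ i i<n → f≡0 (suc i) (s≤s i<n) λ ()))) (ℤP.+-identityʳ (f 0))
  ∑-single (suc n) f (suc z) (s≤s z<n) f≡0 =
    trans (cong (_+ ∑ n (f ∘ suc)) (f≡0 0 (s≤s z≤n) λ ()))
      (trans (ℤP.+-identityˡ _)
        (∑-single n (f ∘ suc) z z<n
          (λ i i<n i≢z → f≡0 (suc i) (s≤s i<n) (i≢z ∘ ℕP.suc-injective))))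

  ∑-split : ∀ m n f → ∑ (m ℕ.+ n) f ≡ ∑ m f + ∑ n (λ i → f (m ℕ.+ i))
  ∑-split zero n f = sym (ℤP.+-identityˡ _)
  ∑-split (suc m) n f = trans (cong (_+_ (f 0)) (∑-split m n (f ∘ suc))) (sym (ℤP.+-assoc (f 0) _ _))

  ∑-periodic : ∀ k L f → (∀ i → f (L ℕ.+ i) ≡ f i) → ∑ (k ℕ.* L) f ≡ + k * ∑ L f
  ∑-periodic zero L f _ = refl
  ∑-periodic (suc k) L f periodic = begin
    ∑ (L ℕ.+ k ℕ.* L) f                       ≡⟨ ∑-split L (k ℕ.* L) f ⟩
    ∑ L f + ∑ (k ℕ.* L) (λ i → f (L ℕ.+ i))   ≡⟨ cong (_+_ (∑ L f)) (∑-cong (k ℕ.* L) periodic) ⟩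
    ∑ L f + ∑ (k ℕ.* L) f                     ≡⟨ cong (_+_ (∑ L f)) (∑-periodic k L f periodic) ⟩
    ∑ L f + + k * ∑ L f                       ≡⟨ sym (ℤP.suc-* (+ k) (∑ L f)) ⟩
    + suc k * ∑ L f                           ∎
    where open ≡-Reasoning

  ∏-cong-< : ∀ n {f g} → (∀ i → i ℕ.< n → f i ≡ g i) → ∏ n f ≡ ∏ n g
  ∏-cong-< zero f≡g = refl
  ∏-cong-< (suc n) f≡g = cong₂ _*_ (f≡g 0 (s≤s z≤n)) (∏-cong-< n (λ i i<n → f≡g (suc i) (s≤s i<n)))

  ∏-one : ∀ n {f} → (∀ i → i ℕ.< n → f i ≡ 1ℤ) → ∏ n f ≡ 1ℤ
  ∏-one zero f≡1 = refl
  ∏-one (suc n) f≡1 = cong₂ _*_ (f≡1 0 (s≤s z≤n)) (∏-one n (λ i i<n → f≡1 (suc i) (s≤s i<n)))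

  ∏-distrib-* : ∀ n f g → ∏ n (λ i → f i * g i) ≡ ∏ n f * ∏ n g
  ∏-distrib-* zero f g = refl
  ∏-distrib-* (suc n) f g =
    trans (cong ((f 0 * g 0) *_) (∏-distrib-* n (f ∘ suc) (g ∘ suc))) (interchange (f 0) (g 0) _ _)
    where
    interchange : ∀ a b c d → (a * b) * (c * d) ≡ (a * c) * (b * d)
    interchange = solve-∀

  ∏-single : ∀ n f z → z ℕ.< n → (∀ i → i ℕ.< n → i ≢ z → f i ≡ 1ℤ) → ∏ n f ≡ f z
  ∏-single (suc n) f zero _ f≡1 =
    trans (cong (f 0 *_) (∏-one n (λ i i<n → f≡1 (suc i) (s≤s i<n) λ ()))) (ℤP.*-identityʳ (f 0))
  ∏-single (suc n) f (suc z) (s≤s z<n) f≡1 =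
    trans (cong (_* ∏ n (f ∘ suc)) (f≡1 0 (s≤s z≤n) λ ()))
      (trans (ℤP.*-identityˡ _)
        (∏-single n (f ∘ suc) z z<n
          (λ i i<n i≢z → f≡1 (suc i) (s≤s i<n) (i≢z ∘ ℕP.suc-injective))))

  ∏-zero : ∀ n f z → z ℕ.< n → f z ≡ 0ℤ → ∏ n f ≡ 0ℤ
  ∏-zero (suc n) f zero _ fz≡0 = cong (_* ∏ n (f ∘ suc)) fz≡0
  ∏-zero (suc n) f (suc z) (s≤s z<n) fz≡0 =
    trans (cong (f 0 *_) (∏-zero n (f ∘ suc) z z<n fz≡0)) (ℤP.*-zeroʳ (f 0))

  ∏-split : ∀ m n f → ∏ (m ℕ.+ n) f ≡ ∏ m f * ∏ n (λ i → f (m ℕ.+ i))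
  ∏-split zero n f = sym (ℤP.*-identityˡ _)
  ∏-split (suc m) n f = trans (cong (f 0 *_) (∏-split m n (f ∘ suc))) (sym (ℤP.*-assoc (f 0) _ _))

  ∏-extend : ∀ m K f → m ℕ.≤ K → (∀ i → m ℕ.≤ i → f i ≡ 1ℤ) → ∏ K f ≡ ∏ m f
  ∏-extend m K f m≤K f≡1 with ℕP.m≤n⇒∃[o]m+o≡n m≤K
  ... | o , refl =
    trans (∏-split m o f)
      (trans (cong (∏ m f *_) (∏-one o (λ i _ → f≡1 (m ℕ.+ i) (ℕP.m≤m+n m i)))) (ℤP.*-identityʳ _))

  sumℤ-applyUpTo : ∀ f n → sumℤ (applyUpTo f n) ≡ ∑ n f
  sumℤ-applyUpTo f zero = refl
  sumℤ-applyUpTo f (suc n) = cong (_+_ (f 0)) (sumℤ-applyUpTo (f ∘ suc) n)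

  prodℤ-applyUpTo : ∀ f n → prodℤ (applyUpTo f n) ≡ ∏ n f
  prodℤ-applyUpTo f zero = refl
  prodℤ-applyUpTo f (suc n) = cong (f 0 *_) (prodℤ-applyUpTo (f ∘ suc) n)

  sumℤ-map-oneTo : ∀ f n → sumℤ (map f (oneTo n)) ≡ ∑ n (f ∘ suc)
  sumℤ-map-oneTo f n =
    trans (cong sumℤ (trans (sym (map-∘ (upTo n))) (map-applyUpTo id (f ∘ suc) n))) (sumℤ-applyUpTo (f ∘ suc) n)

  prodℤ-map-oneTo : ∀ f n → prodℤ (map f (oneTo n)) ≡ ∏ n (f ∘ suc)
  prodℤ-map-oneTo f n =
    trans (cong prodℤ (trans (sym (map-∘ (upTo n))) (map-applyUpTo id (f ∘ suc) n))) (prodℤ-applyUpTo (f ∘ suc) n)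

  sumℤ-filter : ∀ {p} {P : Pred ℕ p} (P? : Decidable P) (F : ℕ → ℤ) xs →
    sumℤ (map F (filter P? xs)) ≡ sumℤ (map (λ x → ⟦ P? x ⟧ * F x) xs)
  sumℤ-filter P? F [] = refl
  sumℤ-filter P? F (x ∷ xs) with P? x
  ... | yes _ = cong₂ _+_ (sym (ℤP.*-identityˡ (F x))) (sumℤ-filter P? F xs)
  ... | no _ = begin
    sumℤ (map F (filter P? xs))            ≡⟨ sumℤ-filter P? F xs ⟩
    rest                                   ≡⟨ sym (ℤP.+-identityˡ rest) ⟩
    0ℤ + rest                              ≡⟨ cong (_+ rest) (sym (ℤP.*-zeroˡ (F x))) ⟩
    0ℤ * F x + rest                        ∎
    where
    open ≡-Reasoning
    rest : ℤ
    rest = sumℤ (map (λ x → ⟦ P? x ⟧ * F x) xs)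

  length-filter : ∀ {p} {P : Pred ℕ p} (P? : Decidable P) xs → + length (filter P? xs) ≡ sumℤ (map (λ x → ⟦ P? x ⟧) xs)
  length-filter P? [] = refl
  length-filter P? (x ∷ xs) with P? x
  ... | yes _ = cong (_+_ 1ℤ) (length-filter P? xs)
  ... | no _ = trans (length-filter P? xs) (sym (ℤP.+-identityˡ _))

  prodℤ-filter : ∀ {p} {P : Pred ℕ p} (P? : Decidable P) (F : ℕ → ℤ) xs →
    prodℤ (map F (filter P? xs)) ≡ prodℤ (map (λ x → if does (P? x) then F x else 1ℤ) xs)
  prodℤ-filter P? F [] = refl
  prodℤ-filter P? F (x ∷ xs) with P? x
  ... | yes _ = cong (F x *_) (prodℤ-filter P? F xs)
  ... | no _ = trans (prodℤ-filter P? F xs) (sym (ℤP.*-identityˡ _))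


module Reindexing where

  open import Data.Nat as ℕ using (ℕ; _<_; _≟_)
  open import Data.Integer using (ℤ; 0ℤ; 1ℤ; _*_)
  import Data.Integer.Properties as ℤP
  open import Relation.Binary.PropositionalEquality
  open import Relation.Nullary using (Dec; yes; no)
  open import Relation.Unary using (Pred; Decidable)
  open import Data.Empty using (⊥-elim)
  open import Function using (_∘_)
  open FiniteSums

  private
    δ-term-zero : ∀ {p} {P : Set p} (P? : Dec P) a b F → (P → a ≢ b) → ⟦ P? ⟧ * (⟦ a ≟ b ⟧ * F) ≡ 0ℤ
    δ-term-zero P? a b F a≢b = ⟦⟧-*-zero P? (λ p → ⟦⟧-*-zero (a ≟ b) (λ a≡b → ⊥-elim (a≢b p a≡b)))

    δ-term-one : ∀ {p} {P : Set p} (P? : Dec P) a F → P → ⟦ P? ⟧ * (⟦ a ≟ a ⟧ * F) ≡ F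
    δ-term-one P? a F p rewrite ⟦⟧-yes P? p | ⟦⟧-yes (a ≟ a) refl =
      trans (ℤP.*-identityˡ _) (ℤP.*-identityˡ F)

    -- Both reindexing lemmas expand [P x] F (g x) as [P x] ∑_y [g x = y] F y and count the fibres of g.
    expand : ∀ {p} {P : Set p} (P? : Dec P) n z (F : ℕ → ℤ) → (P → z < n) →
             ⟦ P? ⟧ * F z ≡ ∑ n (λ y → ⟦ P? ⟧ * (⟦ z ≟ y ⟧ * F y))
    expand (no ¬p) n z F z<n =
      trans (ℤP.*-zeroˡ (F z)) (sym (∑-zero n (λ y _ → δ-term-zero (no ¬p) z y (F y) (λ p → ⊥-elim (¬p p)))))
    expand (yes p) n z F z<n = sym (begin
      ∑ n (λ y → 1ℤ * (⟦ z ≟ y ⟧ * F y))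
        ≡⟨ ∑-single n _ z (z<n p) (λ y _ y≢z → δ-term-zero (yes p) z y (F y) (λ _ z≡y → y≢z (sym z≡y))) ⟩
      1ℤ * (⟦ z ≟ z ⟧ * F z)
        ≡⟨ δ-term-one (yes p) z (F z) p ⟩
      F z
        ≡⟨ sym (ℤP.*-identityˡ (F z)) ⟩
      1ℤ * F z ∎)
      where open ≡-Reasoning

  module _ {p q} {P : Pred ℕ p} {Q : Pred ℕ q} (P? : Decidable P) (Q? : Decidable Q)
           (m n : ℕ) (g h : ℕ → ℕ)
           (P<m : ∀ x → P x → x < m) (Q<n : ∀ y → Q y → y < n)
           (g∈Q : ∀ x → P x → Q (g x)) (h∈P : ∀ y → Q y → P (h y))
           (h∘g : ∀ x → P x → h (g x) ≡ x) (g∘h : ∀ y → Q y → g (h y) ≡ y) where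

    private
      fibre : ∀ F y → ∑ m (λ x → ⟦ P? x ⟧ * (⟦ g x ≟ y ⟧ * F y)) ≡ ⟦ Q? y ⟧ * F y
      fibre F y with Q? y
      ... | no ¬qy =
        trans (∑-zero m (λ x _ → δ-term-zero (P? x) (g x) y (F y) (λ px gx≡y → ¬qy (subst Q gx≡y (g∈Q x px)))))
              (sym (ℤP.*-zeroˡ (F y)))
      ... | yes qy = begin
        ∑ m (λ x → ⟦ P? x ⟧ * (⟦ g x ≟ y ⟧ * F y))
          ≡⟨ ∑-single m _ (h y) (P<m _ (h∈P y qy))
               (λ x _ x≢hy → δ-term-zero (P? x) (g x) y (F y)
                               (λ px gx≡y → x≢hy (trans (sym (h∘g x px)) (cong h gx≡y)))) ⟩
        ⟦ P? (h y) ⟧ * (⟦ g (h y) ≟ y ⟧ * F y)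
          ≡⟨ cong (λ z → ⟦ P? (h y) ⟧ * (⟦ g (h y) ≟ z ⟧ * F z)) (sym (g∘h y qy)) ⟩
        ⟦ P? (h y) ⟧ * (⟦ g (h y) ≟ g (h y) ⟧ * F (g (h y)))
          ≡⟨ δ-term-one (P? (h y)) (g (h y)) _ (h∈P y qy) ⟩
        F (g (h y))
          ≡⟨ trans (cong F (g∘h y qy)) (sym (ℤP.*-identityˡ (F y))) ⟩
        1ℤ * F y ∎
        where
        open ≡-Reasoning

    ∑-reindex : ∀ F → ∑ m (λ x → ⟦ P? x ⟧ * F (g x)) ≡ ∑ n (λ y → ⟦ Q? y ⟧ * F y)
    ∑-reindex F = begin
      ∑ m (λ x → ⟦ P? x ⟧ * F (g x))
        ≡⟨ ∑-cong m (λ x → expand (P? x) n (g x) F (Q<n _ ∘ g∈Q x)) ⟩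
      ∑ m (λ x → ∑ n (λ y → ⟦ P? x ⟧ * (⟦ g x ≟ y ⟧ * F y)))
        ≡⟨ ∑-comm m n _ ⟩
      ∑ n (λ y → ∑ m (λ x → ⟦ P? x ⟧ * (⟦ g x ≟ y ⟧ * F y)))
        ≡⟨ ∑-cong n (fibre F) ⟩
      ∑ n (λ y → ⟦ Q? y ⟧ * F y) ∎
      where open ≡-Reasoning

  module _ {p q} {P : ℕ → ℕ → Set p} {Q : Pred ℕ q} (P? : ∀ x x′ → Dec (P x x′)) (Q? : Decidable Q)
           (m m′ n : ℕ) (g : ℕ → ℕ → ℕ) (h h′ : ℕ → ℕ)
           (P<m : ∀ x x′ → P x x′ → x < m) (P<m′ : ∀ x x′ → P x x′ → x′ < m′) (Q<n : ∀ y → Q y → y < n)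
           (g∈Q : ∀ x x′ → P x x′ → Q (g x x′)) (h∈P : ∀ y → Q y → P (h y) (h′ y))
           (h∘g : ∀ x x′ → P x x′ → h (g x x′) ≡ x) (h′∘g : ∀ x x′ → P x x′ → h′ (g x x′) ≡ x′)
           (g∘h : ∀ y → Q y → g (h y) (h′ y) ≡ y) where

    private
      fibre : ∀ F y → ∑ m (λ x → ∑ m′ (λ x′ → ⟦ P? x x′ ⟧ * (⟦ g x x′ ≟ y ⟧ * F y))) ≡ ⟦ Q? y ⟧ * F y
      fibre F y with Q? y
      ... | no ¬qy =
        trans (∑-zero m (λ x _ → ∑-zero m′ (λ x′ _ → δ-term-zero (P? x x′) (g x x′) y (F y)
                                            (λ pxx′ g≡y → ¬qy (subst Q g≡y (g∈Q x x′ pxx′))))))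
              (sym (ℤP.*-zeroˡ (F y)))
      ... | yes qy = begin
        ∑ m (λ x → ∑ m′ (λ x′ → ⟦ P? x x′ ⟧ * (⟦ g x x′ ≟ y ⟧ * F y)))
          ≡⟨ ∑-single m _ (h y) (P<m _ _ (h∈P y qy))
               (λ x _ x≢hy → ∑-zero m′ (λ x′ _ → δ-term-zero (P? x x′) (g x x′) y (F y)
                               (λ pxx′ g≡y → x≢hy (trans (sym (h∘g x x′ pxx′)) (cong h g≡y))))) ⟩
        ∑ m′ (λ x′ → ⟦ P? (h y) x′ ⟧ * (⟦ g (h y) x′ ≟ y ⟧ * F y))
          ≡⟨ ∑-single m′ _ (h′ y) (P<m′ _ _ (h∈P y qy))
               (λ x′ _ x′≢h′y → δ-term-zero (P? (h y) x′) (g (h y) x′) y (F y)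
                               (λ pxx′ g≡y → x′≢h′y (trans (sym (h′∘g (h y) x′ pxx′)) (cong h′ g≡y)))) ⟩
        ⟦ P? (h y) (h′ y) ⟧ * (⟦ g (h y) (h′ y) ≟ y ⟧ * F y)
          ≡⟨ cong (λ z → ⟦ P? (h y) (h′ y) ⟧ * (⟦ g (h y) (h′ y) ≟ z ⟧ * F z)) (sym (g∘h y qy)) ⟩
        ⟦ P? (h y) (h′ y) ⟧ * (⟦ g (h y) (h′ y) ≟ g (h y) (h′ y) ⟧ * F (g (h y) (h′ y)))
          ≡⟨ δ-term-one (P? (h y) (h′ y)) (g (h y) (h′ y)) _ (h∈P y qy) ⟩
        F (g (h y) (h′ y))
          ≡⟨ trans (cong F (g∘h y qy)) (sym (ℤP.*-identityˡ (F y))) ⟩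
        1ℤ * F y ∎
        where
        open ≡-Reasoning

    ∑∑-reindex : ∀ F → ∑ m (λ x → ∑ m′ (λ x′ → ⟦ P? x x′ ⟧ * F (g x x′))) ≡ ∑ n (λ y → ⟦ Q? y ⟧ * F y)
    ∑∑-reindex F = begin
      ∑ m (λ x → ∑ m′ (λ x′ → ⟦ P? x x′ ⟧ * F (g x x′)))
        ≡⟨ ∑-cong m (λ x → ∑-cong m′ (λ x′ → expand (P? x x′) n (g x x′) F (Q<n _ ∘ g∈Q x x′))) ⟩
      ∑ m (λ x → ∑ m′ (λ x′ → ∑ n (λ y → ⟦ P? x x′ ⟧ * (⟦ g x x′ ≟ y ⟧ * F y))))
        ≡⟨ ∑-cong m (λ x → ∑-comm m′ n _) ⟩
      ∑ m (λ x → ∑ n (λ y → ∑ m′ (λ x′ → ⟦ P? x x′ ⟧ * (⟦ g x x′ ≟ y ⟧ * F y))))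
        ≡⟨ ∑-comm m n _ ⟩
      ∑ n (λ y → ∑ m (λ x → ∑ m′ (λ x′ → ⟦ P? x x′ ⟧ * (⟦ g x x′ ≟ y ⟧ * F y))))
        ≡⟨ ∑-cong n (fibre F) ⟩
      ∑ n (λ y → ⟦ Q? y ⟧ * F y) ∎
      where open ≡-Reasoning


module Arithmetic where

  open import Data.Nat as ℕ using (ℕ; zero; suc; z≤n; s≤s; _≤_; _*_)
  open import Data.Nat.Properties
  open import Data.Nat.Divisibility
  import Data.Nat.DivMod as ℕ
  open import Data.Nat.Coprimality as Coprimality using (Coprime; coprime-divisor)
  open import Data.Nat.Primality
  open import Data.Nat.Primality.Factorisation using (factorise)
  open import Data.Nat.ListAction using (product)
  open import Data.List using ([]; _∷_)
  open import Data.List.Relation.Unary.All using (_∷_)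
  open import Data.Product using (_,_; _×_; ∃)
  open import Data.Sum using (inj₁; inj₂)
  open import Data.Empty using (⊥; ⊥-elim)
  open import Relation.Binary.PropositionalEquality
  open import Relation.Nullary using (¬_)
  open import Defs using (_div_)

  div≡quotient : ∀ {m n} (m∣n : m ∣ n) → 1 ≤ m → n div m ≡ quotient m∣n
  div≡quotient {suc m} m∣n _ = n/m≡quotient m∣n

  m∣n⇒n≡n-div-m*m : ∀ {m n} → m ∣ n → 1 ≤ m → n ≡ (n div m) * m
  m∣n⇒n≡n-div-m*m m∣n m≥1 = trans (m∣n⇒n≡quotient*m m∣n) (cong (_* _) (sym (div≡quotient m∣n m≥1)))

  m*n-div-n≡m : ∀ m n → 1 ≤ n → (m * n) div n ≡ m
  m*n-div-n≡m m (suc n) _ = ℕ.m*n/n≡m m (suc n)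

  n*m-div-n≡m : ∀ n m → 1 ≤ n → (n * m) div n ≡ m
  n*m-div-n≡m n m n≥1 = trans (cong (_div n) (*-comm n m)) (m*n-div-n≡m m n n≥1)

  ∣-pos⇒≤ : ∀ {m n} → 1 ≤ n → m ∣ n → m ≤ n
  ∣-pos⇒≤ {n = suc n} _ = ∣⇒≤

  ∣-pos⇒pos : ∀ {m n} → 1 ≤ n → m ∣ n → 1 ≤ m
  ∣-pos⇒pos {zero} {suc n} _ 0∣n with () ← 0∣⇒≡0 0∣n
  ∣-pos⇒pos {suc m} _ _ = s≤s z≤n

  div-pos : ∀ {m n} → 1 ≤ n → m ∣ n → 1 ≤ n div m
  div-pos {m} {n} n≥1 m∣n with n div m | m∣n⇒n≡n-div-m*m m∣n (∣-pos⇒pos n≥1 m∣n)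
  ... | zero | n≡0 = ⊥-elim (<⇒≢ n≥1 (sym n≡0))
  ... | suc _ | _ = s≤s z≤n

  div-∣ : ∀ {m n} → 1 ≤ n → m ∣ n → n div m ∣ n
  div-∣ {m} {n} n≥1 m∣n = divides m (trans (m∣n⇒n≡n-div-m*m m∣n (∣-pos⇒pos n≥1 m∣n)) (*-comm (n div m) m))

  div-involutive : ∀ {m n} → 1 ≤ n → m ∣ n → n div (n div m) ≡ m
  div-involutive {m} {n} n≥1 m∣n =
    trans (cong (_div (n div m)) (trans (m∣n⇒n≡n-div-m*m m∣n (∣-pos⇒pos n≥1 m∣n)) (*-comm (n div m) m)))
          (m*n-div-n≡m m (n div m) (div-pos n≥1 m∣n))

  prime⇒pos : ∀ {p} → Prime p → 1 ≤ p
  prime⇒pos {suc (suc _)} _ = s≤s z≤n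

  prime⇒≢1 : ∀ {p} → Prime p → p ≢ 1
  prime⇒≢1 {suc (suc _)} _ ()

  prime∣prime⇒≡ : ∀ {p q} → Prime p → Prime q → p ∣ q → p ≡ q
  prime∣prime⇒≡ pp pq p∣q with prime⇒irreducible pq p∣q
  ... | inj₁ p≡1 = ⊥-elim (prime⇒≢1 pp p≡1)
  ... | inj₂ p≡q = p≡q

  prime∤⇒coprime : ∀ {p n} → Prime p → ¬ p ∣ n → Coprime p n
  prime∤⇒coprime pp p∤n (d∣p , d∣n) with prime⇒irreducible pp d∣p
  ... | inj₁ d≡1 = d≡1
  ... | inj₂ refl = ⊥-elim (p∤n d∣n)

  prime∣*∤ˡ⇒∣ʳ : ∀ {p m n} → Prime p → p ∣ m * n → ¬ p ∣ m → p ∣ n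
  prime∣*∤ˡ⇒∣ʳ {m = m} {n} pp p∣mn p∤m with euclidsLemma m n pp p∣mn
  ... | inj₁ p∣m = ⊥-elim (p∤m p∣m)
  ... | inj₂ p∣n = p∣n

  prime∣*∤ʳ⇒∣ˡ : ∀ {p m n} → Prime p → p ∣ m * n → ¬ p ∣ n → p ∣ m
  prime∣*∤ʳ⇒∣ˡ {m = m} {n} pp p∣mn p∤n with euclidsLemma m n pp p∣mn
  ... | inj₁ p∣m = p∣m
  ... | inj₂ p∣n = ⊥-elim (p∤n p∣n)

  ∃primeFactor : ∀ n → 2 ≤ n → ∃ λ p → Prime p × p ∣ n
  ∃primeFactor (suc zero) (s≤s ())
  ∃primeFactor n@(suc (suc _)) _ with factorise n
  ... | record { factors = [] ; isFactorisation = () }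
  ... | record { factors = p ∷ ps ; isFactorisation = n≡p*ps ; factorsPrime = pp ∷ _ } =
    p , pp , divides (product ps) (trans n≡p*ps (*-comm p (product ps)))

  coprime-∣-∣⇒*∣ : ∀ {m n k} → Coprime m n → m ∣ k → n ∣ k → m * n ∣ k
  coprime-∣-∣⇒*∣ {m} {n} coprime (divides u refl) n∣um =
    subst (m * n ∣_) (*-comm m u)
      (*-monoʳ-∣ m (coprime-divisor (Coprimality.sym coprime) (subst (n ∣_) (*-comm u m) n∣um)))

  coprime-∣-∣ : ∀ {m n m′ n′} → Coprime m n → m′ ∣ m → n′ ∣ n → Coprime m′ n′
  coprime-∣-∣ coprime m′∣m n′∣n (d∣m′ , d∣n′) = coprime (∣-trans d∣m′ m′∣m , ∣-trans d∣n′ n′∣n)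

  no-common-prime⇒coprime : ∀ {m n} → 1 ≤ m → (∀ p → Prime p → p ∣ m → p ∣ n → ⊥) → Coprime m n
  no-common-prime⇒coprime {m} {n} m≥1 no-common {d} (d∣m , d∣n) with d
  ... | zero = ⊥-elim (<⇒≢ m≥1 (sym (0∣⇒≡0 d∣m)))
  ... | suc zero = refl
  ... | suc (suc d-2) with ∃primeFactor (suc (suc d-2)) (s≤s (s≤s z≤n))
  ...   | p , pp , p∣d = ⊥-elim (no-common p pp (∣-trans p∣d d∣m) (∣-trans p∣d d∣n))


module Möbius where

  open import Data.Nat as ℕ using (ℕ; suc; s≤s; _≤_; _*_; NonZero; >-nonZero)
  open import Data.Nat.Properties
  open import Data.Nat.Divisibility
  open import Data.Nat.Coprimality using (Coprime)
  open import Data.Nat.Primality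
  open import Data.Integer using (ℤ; 0ℤ; 1ℤ; -1ℤ) renaming (_*_ to _*ℤ_; -_ to -ℤ_)
  import Data.Integer.Properties as ℤP
  open import Data.List using (map; filter)
  open import Data.Bool using (if_then_else_)
  open import Data.Product using (_,_; _×_; proj₁; proj₂)
  open import Data.Empty using (⊥-elim)
  open import Function using (_∘_)
  open import Relation.Binary.PropositionalEquality
  open import Relation.Nullary using (Dec; yes; no; ¬_; does)
  open import Relation.Nullary.Decidable using (_×-dec_)
  open import Defs using (μ; prodℤ; oneTo)
  open FiniteSums
  open Arithmetic

  primeDivisor? : (n p : ℕ) → Dec (Prime p × p ∣ n)
  primeDivisor? n p = prime? p ×-dec p ∣? n

  private
    mappedFunction : ∀ {F : ℕ → ℤ} xs {z} → z ≡ prodℤ (map F xs) → ℕ → ℤ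
    mappedFunction {F} _ _ = F

  -- The factor function of the definition of μ is local to it; it is named here by unification.
  μ-factor : ℕ → ℕ → ℤ
  μ-factor n = mappedFunction (filter (primeDivisor? n) (oneTo n)) {μ n} refl

  μ-local : ℕ → ℕ → ℤ
  μ-local n x = if does (primeDivisor? n x) then μ-factor n x else 1ℤ

  μ≡∏μ-local : ∀ n → μ n ≡ ∏ n (μ-local n ∘ suc)
  μ≡∏μ-local n = trans (prodℤ-filter (primeDivisor? n) (μ-factor n) (oneTo n)) (prodℤ-map-oneTo (μ-local n) n)

  μ-local-∤ : ∀ n x → ¬ (Prime x × x ∣ n) → μ-local n x ≡ 1ℤ
  μ-local-∤ n x ¬x∣n with prime? x | x ∣? n
  ... | yes px | yes x∣n = ⊥-elim (¬x∣n (px , x∣n))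
  ... | yes _  | no _    = refl
  ... | no _   | _       = refl

  μ-local-square : ∀ n x → Prime x → x * x ∣ n → μ-local n x ≡ 0ℤ
  μ-local-square n x px x²∣n with prime? x | x ∣? n | (x * x) ∣? n
  ... | no ¬px | _       | _        = ⊥-elim (¬px px)
  ... | yes _  | no x∤n  | _        = ⊥-elim (x∤n (m*n∣⇒m∣ x x x²∣n))
  ... | yes _  | yes _   | no x²∤n  = ⊥-elim (x²∤n x²∣n)
  ... | yes _  | yes _   | yes _    = refl

  μ-local-simple : ∀ n x → Prime x → x ∣ n → ¬ x * x ∣ n → μ-local n x ≡ -1ℤ
  μ-local-simple n x px x∣n x²∤n with prime? x | x ∣? n | (x * x) ∣? n
  ... | no ¬px | _       | _        = ⊥-elim (¬px px)
  ... | yes _  | no x∤n  | _        = ⊥-elim (x∤n x∣n)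
  ... | yes _  | yes _   | yes x²∣n = ⊥-elim (x²∤n x²∣n)
  ... | yes _  | yes _   | no _     = refl

  μ≡∏μ-local-beyond : ∀ n K → 1 ≤ n → n ≤ K → μ n ≡ ∏ K (μ-local n ∘ suc)
  μ≡∏μ-local-beyond n K n≥1 n≤K =
    trans (μ≡∏μ-local n)
      (sym (∏-extend n K _ n≤K (λ i n≤i → μ-local-∤ n (suc i)
             (λ (_ , i+1∣n) → <⇒≱ (s≤s n≤i) (∣-pos⇒≤ n≥1 i+1∣n)))))

  μ-square : ∀ n p → 1 ≤ n → Prime p → p * p ∣ n → μ n ≡ 0ℤ
  μ-square n p@(suc p-1) n≥1 pp p²∣n =
    trans (μ≡∏μ-local n) (∏-zero n _ p-1 (∣-pos⇒≤ n≥1 (m*n∣⇒m∣ p p p²∣n)) (μ-local-square n p pp p²∣n))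

  prime⇒square∤ : ∀ {p} → Prime p → ¬ p * p ∣ p
  prime⇒square∤ {p} pp p²∣p = prime⇒≢1 pp (∣1⇒≡1 (*-cancelˡ-∣ p (subst (p * p ∣_) (sym (*-identityʳ p)) p²∣p)))
    where
    instance
      p≢0 : NonZero p
      p≢0 = prime⇒nonZero pp

  μ-prime : ∀ p → Prime p → μ p ≡ -1ℤ
  μ-prime p@(suc p-1) pp =
    trans (μ≡∏μ-local p)
      (trans (∏-single p _ p-1 ≤-refl
               (λ i _ i≢p-1 → μ-local-∤ p (suc i) (λ (pi , i+1∣p) → i≢p-1 (suc-injective (prime∣prime⇒≡ pi pp i+1∣p)))))
             (μ-local-simple p p pp ∣-refl (prime⇒square∤ pp)))

  square∣*∤ʳ⇒square∣ˡ : ∀ {x a b} → Prime x → ¬ x ∣ b → x * x ∣ a * b → x * x ∣ a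
  square∣*∤ʳ⇒square∣ˡ {x} {a} {b} px x∤b x²∣ab with prime∣*∤ʳ⇒∣ˡ {m = a} px (m*n∣⇒m∣ x x x²∣ab) x∤b
  ... | divides a′ refl = *-monoˡ-∣ x (prime∣*∤ʳ⇒∣ˡ {m = a′} px (*-cancelˡ-∣ x x∣a′b) x∤b)
    where
    instance
      x≢0 : NonZero x
      x≢0 = prime⇒nonZero px
    x∣a′b : x * x ∣ x * (a′ * b)
    x∣a′b = subst (x * x ∣_) (trans (cong (_* b) (*-comm a′ x)) (*-assoc x a′ b)) x²∣ab

  μ-local-*-∤ʳ : ∀ a b x → Prime x → ¬ x ∣ b → μ-local (a * b) x ≡ μ-local a x
  μ-local-*-∤ʳ a b x px x∤b = cases (x ∣? a) ((x * x) ∣? a)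
    where
    cases : Dec (x ∣ a) → Dec (x * x ∣ a) → μ-local (a * b) x ≡ μ-local a x
    cases (no x∤a) _ = trans (μ-local-∤ (a * b) x (λ (_ , x∣ab) → x∤a (prime∣*∤ʳ⇒∣ˡ px x∣ab x∤b)))
                             (sym (μ-local-∤ a x (x∤a ∘ proj₂)))
    cases (yes x∣a) (yes x²∣a) =
      trans (μ-local-square (a * b) x px (∣m⇒∣m*n b x²∣a)) (sym (μ-local-square a x px x²∣a))
    cases (yes x∣a) (no x²∤a) =
      trans (μ-local-simple (a * b) x px (∣m⇒∣m*n b x∣a) (x²∤a ∘ square∣*∤ʳ⇒square∣ˡ px x∤b))
            (sym (μ-local-simple a x px x∣a x²∤a))

  μ-local-* : ∀ a b x → Coprime a b → μ-local (a * b) x ≡ μ-local a x *ℤ μ-local b x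
  μ-local-* a b x coprime = cases (prime? x) (x ∣? b)
    where
    cases : Dec (Prime x) → Dec (x ∣ b) → μ-local (a * b) x ≡ μ-local a x *ℤ μ-local b x
    cases (no ¬px) _
      rewrite μ-local-∤ (a * b) x (¬px ∘ proj₁) | μ-local-∤ a x (¬px ∘ proj₁) | μ-local-∤ b x (¬px ∘ proj₁) = refl
    cases (yes px) (no x∤b) =
      trans (μ-local-*-∤ʳ a b x px x∤b)
            (sym (trans (cong (μ-local a x *ℤ_) (μ-local-∤ b x (x∤b ∘ proj₂))) (ℤP.*-identityʳ _)))
    cases (yes px) (yes x∣b) =
      trans (cong (λ n → μ-local n x) (*-comm a b))
        (trans (μ-local-*-∤ʳ b a x px x∤a)
          (sym (trans (cong (_*ℤ μ-local b x) (μ-local-∤ a x (x∤a ∘ proj₂))) (ℤP.*-identityˡ _))))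
      where
      x∤a : ¬ x ∣ a
      x∤a x∣a = prime⇒≢1 px (coprime (x∣a , x∣b))

  μ-multiplicative : ∀ a b → 1 ≤ a → 1 ≤ b → Coprime a b → μ (a * b) ≡ μ a *ℤ μ b
  μ-multiplicative a b a≥1 b≥1 coprime = begin
    μ (a * b)
      ≡⟨ μ≡∏μ-local (a * b) ⟩
    ∏ (a * b) (μ-local (a * b) ∘ suc)
      ≡⟨ ∏-cong-< (a * b) (λ i _ → μ-local-* a b (suc i) coprime) ⟩
    ∏ (a * b) (λ i → μ-local a (suc i) *ℤ μ-local b (suc i))
      ≡⟨ ∏-distrib-* (a * b) _ _ ⟩
    ∏ (a * b) (μ-local a ∘ suc) *ℤ ∏ (a * b) (μ-local b ∘ suc)
      ≡⟨ sym (cong₂ _*ℤ_ (μ≡∏μ-local-beyond a (a * b) a≥1 (m≤m*n a b)) (μ≡∏μ-local-beyond b (a * b) b≥1 (m≤n*m b a))) ⟩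
    μ a *ℤ μ b ∎
    where
    open ≡-Reasoning
    instance
      a≢0 : NonZero a
      a≢0 = >-nonZero a≥1
      b≢0 : NonZero b
      b≢0 = >-nonZero b≥1

  μ-prime-* : ∀ p m → Prime p → ¬ p ∣ m → 1 ≤ m → μ (p * m) ≡ -ℤ μ m
  μ-prime-* p m pp p∤m m≥1 =
    trans (μ-multiplicative p m (prime⇒pos pp) m≥1 (prime∤⇒coprime pp p∤m))
          (trans (cong (_*ℤ μ m) (μ-prime p pp)) (ℤP.-1*i≡-i (μ m)))


module Congruences where

  open import Data.Nat as ℕ using (ℕ; _≤_; _<_; _∸_; NonZero; >-nonZero) renaming (_+_ to _+ℕ_; _*_ to _*ℕ_)
  import Data.Nat.Properties as ℕP
  open import Data.Nat.Divisibility
  open import Data.Nat.GCD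
  open import Data.Nat.LCM
  import Data.Nat.Tactic.RingSolver as ℕ-Solver
  open import Data.Integer as ℤ using (ℤ; +_; 0ℤ; 1ℤ; ∣_∣; _+_; _*_; -_; _-_)
  import Data.Integer.Properties as ℤP
  open import Data.Integer.DivMod using (_%ℕ_; _/ℕ_; n%ℕd<d; a≡a%ℕn+[a/ℕn]*n)
  open import Data.Integer.Divisibility.Signed as Signed using (divides) renaming (_∣_ to _∣ℤ_)
  open import Data.Integer.Tactic.RingSolver using (solve-∀)
  open import Data.Product using (_,_; _×_; ∃; ∃₂; proj₁; proj₂)
  open import Data.Sum using (inj₁; inj₂)
  open import Data.Empty using (⊥-elim)
  open import Relation.Binary.PropositionalEquality
  open import Relation.Nullary using (Dec; yes; no; ¬_)
  open import Relation.Nullary.Decidable using (_×-dec_)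
  open import Defs using (_div_)
  open FiniteSums
  open Arithmetic

  ∣∣⇒∣ℤ : ∀ {d} z → d ∣ ∣ z ∣ → + d ∣ℤ z
  ∣∣⇒∣ℤ z = Signed.∣ᵤ⇒∣ {i = z}

  ∣ℤ⇒∣∣ : ∀ {d z} → + d ∣ℤ z → d ∣ ∣ z ∣
  ∣ℤ⇒∣∣ = Signed.∣⇒∣ᵤ

  ⟦∣∣⟧-congruent : ∀ d x y → + d ∣ℤ x - y → ⟦ d ∣? ∣ x ∣ ⟧ ≡ ⟦ d ∣? ∣ y ∣ ⟧
  ⟦∣∣⟧-congruent d x y d∣x-y = ⟦⟧-cong (d ∣? ∣ x ∣) (d ∣? ∣ y ∣)
    (λ d∣x → ∣ℤ⇒∣∣ (subst (+ d ∣ℤ_) (x-[x-y]≡y x y) (Signed.∣m∣n⇒∣m-n (∣∣⇒∣ℤ x d∣x) d∣x-y)))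
    (λ d∣y → ∣ℤ⇒∣∣ (subst (+ d ∣ℤ_) ([x-y]+y≡x x y) (Signed.∣m∣n⇒∣m+n d∣x-y (∣∣⇒∣ℤ y d∣y))))
    where
    x-[x-y]≡y : ∀ x y → x - (x - y) ≡ y
    x-[x-y]≡y = solve-∀
    [x-y]+y≡x : ∀ x y → (x - y) + y ≡ x
    [x-y]+y≡x = solve-∀

  private
    <-∣⇒≡0 : ∀ {L n} → n < L → L ∣ n → n ≡ 0
    <-∣⇒≡0 {n = ℕ.zero} _ _ = refl
    <-∣⇒≡0 {n = ℕ.suc n} n<L L∣n = ⊥-elim (ℕP.<⇒≢ (ℕP.<-≤-trans n<L (∣⇒≤ L∣n)) refl)

    ∣∸⇒≤ : ∀ {L i z} → z < L → L ∣ z ∸ i → z ≤ i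
    ∣∸⇒≤ {L} {i} {z} z<L L∣z∸i = ℕP.m∸n≡0⇒m≤n (<-∣⇒≡0 (ℕP.≤-<-trans (ℕP.m∸n≤m z i) z<L) L∣z∸i)

  ∣difference∣-<⇒≡ : ∀ {L i z} → i < L → z < L → L ∣ ∣ + i - + z ∣ → i ≡ z
  ∣difference∣-<⇒≡ {L} {i} {z} i<L z<L L∣i-z with ℕP.≤-total i z
  ... | inj₁ i≤z = ℕP.≤-antisym i≤z (∣∸⇒≤ z<L (subst (L ∣_) ∣i-z∣≡z∸i L∣i-z))
    where
    ∣i-z∣≡z∸i : ∣ + i - + z ∣ ≡ z ∸ i
    ∣i-z∣≡z∸i = trans (cong ∣_∣ (ℤP.m-n≡m⊖n i z)) (ℤP.∣⊖∣-≤ i≤z)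
  ... | inj₂ z≤i = sym (ℕP.≤-antisym z≤i (∣∸⇒≤ i<L (subst (L ∣_) ∣i-z∣≡i∸z L∣i-z)))
    where
    ∣i-z∣≡i∸z : ∣ + i - + z ∣ ≡ i ∸ z
    ∣i-z∣≡i∸z = trans (cong ∣_∣ (ℤP.m-n≡m⊖n i z)) (trans (ℤP.∣m⊖n∣≡∣n⊖m∣ i z) (ℤP.∣⊖∣-≤ z≤i))

  ∑[L∣a-a₀]≡r/L : ∀ r L a₀ → 1 ≤ L → L ∣ r → ∑ r (λ a → ⟦ L ∣? ∣ + a - a₀ ∣ ⟧) ≡ + (r div L)
  ∑[L∣a-a₀]≡r/L r L a₀ L≥1 L∣r = begin
    ∑ r f                      ≡⟨ cong (λ n → ∑ n f) (m∣n⇒n≡n-div-m*m L∣r L≥1) ⟩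
    ∑ (r div L ℕ.* L) f        ≡⟨ ∑-periodic (r div L) L f periodic ⟩
    + (r div L) * ∑ L f        ≡⟨ cong (+ (r div L) *_) one-residue ⟩
    + (r div L) * 1ℤ           ≡⟨ ℤP.*-identityʳ _ ⟩
    + (r div L)                ∎
    where
    open ≡-Reasoning
    instance
      L≢0 : NonZero L
      L≢0 = >-nonZero L≥1
    f : ℕ → ℤ
    f a = ⟦ L ∣? ∣ + a - a₀ ∣ ⟧

    periodic : ∀ i → f (L +ℕ i) ≡ f i
    periodic i = ⟦∣∣⟧-congruent L (+ (L +ℕ i) - a₀) (+ i - a₀)
      (divides 1ℤ (trans (cong (λ n → n - a₀ - (+ i - a₀)) (ℤP.pos-+ L i)) (shift (+ L) (+ i) a₀)))
      where
      shift : ∀ l i a → (l + i) - a - (i - a) ≡ 1ℤ * l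
      shift = solve-∀

    z : ℕ
    z = a₀ %ℕ L

    L∣z-a₀ : + L ∣ℤ + z - a₀
    L∣z-a₀ = divides (- (a₀ /ℕ L)) (trans (cong (_-_ (+ z)) (a≡a%ℕn+[a/ℕn]*n a₀ L)) (z-[z+qL]≡-qL (+ z) (a₀ /ℕ L) (+ L)))
      where
      z-[z+qL]≡-qL : ∀ z q l → z - (z + q * l) ≡ (- q) * l
      z-[z+qL]≡-qL = solve-∀

    one-residue : ∑ L f ≡ 1ℤ
    one-residue = trans
      (∑-single L f z (n%ℕd<d a₀ L) (λ i i<L i≢z → ⟦⟧-no (L ∣? ∣ + i - a₀ ∣) (λ L∣i-a₀ →
        i≢z (∣difference∣-<⇒≡ i<L (n%ℕd<d a₀ L)
              (∣ℤ⇒∣∣ (subst (+ L ∣ℤ_) ([i-a]-[z-a]≡i-z (+ i) (+ z) a₀)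
                                  (Signed.∣m∣n⇒∣m-n (∣∣⇒∣ℤ (+ i - a₀) L∣i-a₀) L∣z-a₀)))))))
      (⟦⟧-yes (L ∣? ∣ + z - a₀ ∣) (∣ℤ⇒∣∣ L∣z-a₀))
      where
      [i-a]-[z-a]≡i-z : ∀ i z a → (i - a) - (z - a) ≡ i - z
      [i-a]-[z-a]≡i-z = solve-∀

  bézoutℤ : ∀ d e → ∃₂ λ u v → u * + d + v * + e ≡ + gcd d e
  bézoutℤ d e with Bézout.identity (gcd-GCD d e)
  ... | Bézout.+- x y g+ye≡xd = + x , - + y , (begin
    + x * + d + - + y * + e                    ≡⟨ cong (λ n → n + - + y * + e) (sym (lift g+ye≡xd)) ⟩
    (+ gcd d e + + y * + e) + - + y * + e      ≡⟨ cancel (+ gcd d e) (+ y) (+ e) ⟩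
    + gcd d e                                  ∎)
    where
    open ≡-Reasoning
    lift : gcd d e +ℕ y *ℕ e ≡ x *ℕ d → + gcd d e + + y * + e ≡ + x * + d
    lift eq = trans (cong (_+_ (+ gcd d e)) (sym (ℤP.pos-* y e)))
                    (trans (sym (ℤP.pos-+ (gcd d e) (y *ℕ e))) (trans (cong +_ eq) (ℤP.pos-* x d)))
    cancel : ∀ g y e → (g + y * e) + - y * e ≡ g
    cancel = solve-∀
  ... | Bézout.-+ x y g+xd≡ye = - + x , + y , (begin
    - + x * + d + + y * + e                    ≡⟨ cong (_+_ (- + x * + d)) (sym (lift g+xd≡ye)) ⟩
    - + x * + d + (+ gcd d e + + x * + d)      ≡⟨ cancel (+ gcd d e) (+ x) (+ d) ⟩
    + gcd d e                                  ∎)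
    where
    open ≡-Reasoning
    lift : gcd d e +ℕ x *ℕ d ≡ y *ℕ e → + gcd d e + + x * + d ≡ + y * + e
    lift eq = trans (cong (_+_ (+ gcd d e)) (sym (ℤP.pos-* x d)))
                    (trans (sym (ℤP.pos-+ (gcd d e) (x *ℕ d))) (trans (cong +_ eq) (ℤP.pos-* y e)))
    cancel : ∀ g x d → - x * d + (g + x * d) ≡ g
    cancel = solve-∀

  chinese-remainder : ∀ d e x y → gcd d e ∣ ∣ x - y ∣ → ∃ λ a₀ → + d ∣ℤ x - a₀ × + e ∣ℤ a₀ - y
  chinese-remainder d e x y g∣x-y with ∣∣⇒∣ℤ (x - y) g∣x-y | bézoutℤ d e
  ... | divides w x-y≡wg | u , v , ud+ve≡g = x - w * (u * + d) , divides (w * u) (x-[x-t]≡t x w u (+ d)) , divides (w * v) (begin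
    (x - w * (u * + d)) - y                        ≡⟨ regroup x y (w * (u * + d)) ⟩
    (x - y) - w * (u * + d)                        ≡⟨ cong (λ n → n - w * (u * + d)) x-y≡wg ⟩
    w * + gcd d e - w * (u * + d)                  ≡⟨ cong (λ n → w * n - w * (u * + d)) (sym ud+ve≡g) ⟩
    w * (u * + d + v * + e) - w * (u * + d)        ≡⟨ distribute w u (+ d) v (+ e) ⟩
    (w * v) * + e                                  ∎)
    where
    open ≡-Reasoning
    x-[x-t]≡t : ∀ x w u d → x - (x - w * (u * d)) ≡ (w * u) * d
    x-[x-t]≡t = solve-∀
    regroup : ∀ x y t → (x - t) - y ≡ (x - y) - t
    regroup = solve-∀
    distribute : ∀ w u d v e → w * (u * d + v * e) - w * (u * d) ≡ (w * v) * e
    distribute = solve-∀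

  module _ (r d e : ℕ) (x y : ℤ) (r≥1 : 1 ≤ r) (d∣r : d ∣ r) (e∣r : e ∣ r) where

    private
      g L : ℕ
      g = gcd d e
      L = lcm d e

      solutions : ℕ → ℤ
      solutions a = ⟦ d ∣? ∣ x - + a ∣ ⟧ * ⟦ e ∣? ∣ + a - y ∣ ⟧

      L∣r : L ∣ r
      L∣r = lcm-least d∣r e∣r

      unsolvable : ¬ g ∣ ∣ x - y ∣ → ∑ r solutions ≡ 0ℤ
      unsolvable g∤x-y = ∑-zero r (λ a _ → ⟦⟧-*-zero (d ∣? ∣ x - + a ∣) (λ d∣x-a → ⟦⟧-no (e ∣? ∣ + a - y ∣) (λ e∣a-y →
        g∤x-y (∣ℤ⇒∣∣ (subst (+ g ∣ℤ_) (telescope x (+ a) y)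
          (Signed.∣m∣n⇒∣m+n (Signed.∣-trans (∣∣⇒∣ℤ (+ d) (gcd[m,n]∣m d e)) (∣∣⇒∣ℤ (x - + a) d∣x-a))
                            (Signed.∣-trans (∣∣⇒∣ℤ (+ e) (gcd[m,n]∣n d e)) (∣∣⇒∣ℤ (+ a - y) e∣a-y))))))))
        where
        telescope : ∀ x a y → (x - a) + (a - y) ≡ x - y
        telescope = solve-∀

      module Solvable (solution : ∃ λ a₀ → + d ∣ℤ x - a₀ × + e ∣ℤ a₀ - y) where
        a₀ : ℤ
        a₀ = proj₁ solution

        d∣x-a₀ : + d ∣ℤ x - a₀
        d∣x-a₀ = proj₁ (proj₂ solution)

        e∣a₀-y : + e ∣ℤ a₀ - y
        e∣a₀-y = proj₂ (proj₂ solution)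

        solution≡[L∣a-a₀] : ∀ a → solutions a ≡ ⟦ L ∣? ∣ + a - a₀ ∣ ⟧
        solution≡[L∣a-a₀] a = begin
          ⟦ d ∣? ∣ x - + a ∣ ⟧ * ⟦ e ∣? ∣ + a - y ∣ ⟧
            ≡⟨ cong₂ _*_ (trans (⟦∣∣⟧-congruent d (x - + a) (a₀ - + a) (subst (+ d ∣ℤ_) (sym (diff₁ x (+ a) a₀)) d∣x-a₀))
                                (cong (λ n → ⟦ d ∣? n ⟧) (ℤP.∣i-j∣≡∣j-i∣ a₀ (+ a))))
                         (⟦∣∣⟧-congruent e (+ a - y) (+ a - a₀) (subst (+ e ∣ℤ_) (sym (diff₂ (+ a) y a₀)) e∣a₀-y)) ⟩
          ⟦ d ∣? ∣ + a - a₀ ∣ ⟧ * ⟦ e ∣? ∣ + a - a₀ ∣ ⟧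
            ≡⟨ sym (⟦⟧-×-dec (d ∣? ∣ + a - a₀ ∣) (e ∣? ∣ + a - a₀ ∣)) ⟩
          ⟦ (d ∣? ∣ + a - a₀ ∣) ×-dec (e ∣? ∣ + a - a₀ ∣) ⟧
            ≡⟨ ⟦⟧-cong ((d ∣? ∣ + a - a₀ ∣) ×-dec (e ∣? ∣ + a - a₀ ∣)) (L ∣? ∣ + a - a₀ ∣)
                       (λ (d∣ , e∣) → lcm-least d∣ e∣)
                       (λ L∣ → ∣-trans (m∣lcm[m,n] d e) L∣ , ∣-trans (n∣lcm[m,n] d e) L∣) ⟩
          ⟦ L ∣? ∣ + a - a₀ ∣ ⟧ ∎
          where
          open ≡-Reasoning
          diff₁ : ∀ x a a₀ → (x - a) - (a₀ - a) ≡ x - a₀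
          diff₁ = solve-∀
          diff₂ : ∀ a y a₀ → (a - y) - (a - a₀) ≡ a₀ - y
          diff₂ = solve-∀

        ∑solutions≡r/L : ∑ r solutions ≡ + (r div L)
        ∑solutions≡r/L = trans (∑-cong r solution≡[L∣a-a₀]) (∑[L∣a-a₀]≡r/L r L a₀ (∣-pos⇒pos r≥1 L∣r) L∣r)

      d*e*r/L≡r*g : d *ℕ (e *ℕ (r div L)) ≡ r *ℕ g
      d*e*r/L≡r*g = begin
        d *ℕ (e *ℕ k)     ≡⟨ sym (ℕP.*-assoc d e k) ⟩
        (d *ℕ e) *ℕ k     ≡⟨ cong (_*ℕ k) (sym (gcd*lcm d e)) ⟩
        (g *ℕ L) *ℕ k     ≡⟨ reorder g L k ⟩
        (k *ℕ L) *ℕ g     ≡⟨ cong (_*ℕ g) (sym (m∣n⇒n≡n-div-m*m L∣r (∣-pos⇒pos r≥1 L∣r))) ⟩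
        r *ℕ g            ∎
        where
        open ≡-Reasoning
        k : ℕ
        k = r div L
        reorder : ∀ g L k → (g *ℕ L) *ℕ k ≡ (k *ℕ L) *ℕ g
        reorder = ℕ-Solver.solve-∀

      count : (g∣? : Dec (g ∣ ∣ x - y ∣)) → + d * (+ e * ∑ r solutions) ≡ + r * (⟦ g∣? ⟧ * + g)
      count (no g∤x-y) = begin
        + d * (+ e * ∑ r solutions)   ≡⟨ cong (λ s → + d * (+ e * s)) (unsolvable g∤x-y) ⟩
        + d * (+ e * 0ℤ)              ≡⟨ trans (cong (_*_ (+ d)) (ℤP.*-zeroʳ (+ e))) (ℤP.*-zeroʳ (+ d)) ⟩
        0ℤ                            ≡⟨ sym (trans (cong (_*_ (+ r)) (ℤP.*-zeroˡ (+ g))) (ℤP.*-zeroʳ (+ r))) ⟩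
        + r * (0ℤ * + g)              ∎
        where open ≡-Reasoning
      count (yes g∣x-y) = begin
        + d * (+ e * ∑ r solutions)   ≡⟨ cong (λ s → + d * (+ e * s)) (Solvable.∑solutions≡r/L (chinese-remainder d e x y g∣x-y)) ⟩
        + d * (+ e * + (r div L))     ≡⟨ cong (_*_ (+ d)) (sym (ℤP.pos-* e (r div L))) ⟩
        + d * + (e *ℕ (r div L))      ≡⟨ sym (ℤP.pos-* d (e *ℕ (r div L))) ⟩
        + (d *ℕ (e *ℕ (r div L)))     ≡⟨ cong +_ d*e*r/L≡r*g ⟩
        + (r *ℕ g)                    ≡⟨ ℤP.pos-* r g ⟩
        + r * + g                     ≡⟨ cong (_*_ (+ r)) (sym (ℤP.*-identityˡ (+ g))) ⟩
        + r * (1ℤ * + g)              ∎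
        where open ≡-Reasoning

    ∑[d∣x-a][e∣a-y] : + d * (+ e * ∑ r (λ a → ⟦ d ∣? ∣ x - + a ∣ ⟧ * ⟦ e ∣? ∣ + a - y ∣ ⟧))
                      ≡ + r * (⟦ gcd d e ∣? ∣ x - y ∣ ⟧ * + gcd d e)
    ∑[d∣x-a][e∣a-y] = count (gcd d e ∣? ∣ x - y ∣)


module RamanujanSum where

  open import Data.Nat as ℕ using (ℕ; suc; z≤n; s≤s; _≤_; _+_; _*_; _≟_; NonZero; >-nonZero)
  open import Data.Nat.Properties
  open import Data.Nat.Divisibility
  open import Data.Nat.Primality using (Prime)
  open import Data.Nat.GCD
  open import Data.Nat.Tactic.RingSolver using (solve-∀)
  open import Data.Integer.Tactic.RingSolver renaming (solve-∀ to solve-∀ℤ)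
  open import Data.Integer.Divisibility.Signed as Signed using () renaming (_∣_ to _∣ℤ_)
  open import Data.Integer as ℤ using (ℤ; +_; 0ℤ; 1ℤ; ∣_∣) renaming (_*_ to _*ℤ_; _+_ to _+ℤ_; -_ to -ℤ_)
  import Data.Integer.Properties as ℤP
  open import Data.List using (map; filter)
  open import Data.Product using (_,_; _×_; proj₁; proj₂)
  open import Data.Empty using (⊥-elim)
  open import Relation.Binary.PropositionalEquality
  open import Relation.Nullary using (Dec; yes; no; ¬_)
  open import Relation.Nullary.Decidable using (_×-dec_; ¬?)
  open import Defs using (μ; c; φ; oneTo; _div_; sumℤ)
  open FiniteSums
  open Reindexing
  open Arithmetic
  open Möbius
  open Congruences

  ∑∣ : ℕ → (ℕ → ℤ) → ℤ
  ∑∣ r F = ∑ (suc r) (λ d → ⟦ d ∣? r ⟧ *ℤ F d)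

  ∑∣-cong : ∀ r {F G} → (∀ d → d ∣ r → F d ≡ G d) → ∑∣ r F ≡ ∑∣ r G
  ∑∣-cong r F≡G = ∑-cong (suc r) (λ d → ⟦⟧-* (d ∣? r) (F≡G d))

  ∑∣≡∑-positive : ∀ r F → 1 ≤ r → ∑∣ r F ≡ ∑ r (λ i → ⟦ suc i ∣? r ⟧ *ℤ F (suc i))
  ∑∣≡∑-positive (suc r) F _ =
    trans (cong (_+ℤ ∑ (suc r) (λ i → ⟦ suc i ∣? suc r ⟧ *ℤ F (suc i))) (ℤP.*-zeroˡ (F 0))) (ℤP.+-identityˡ _)

  c≡∑∣ : ∀ r k → 1 ≤ r → c r k ≡ ∑∣ r (λ d → ⟦ d ∣? ∣ k ∣ ⟧ *ℤ (μ (r div d) *ℤ + d))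
  c≡∑∣ r k r≥1 = begin
    c r k
      ≡⟨ sumℤ-filter (λ d → (d ∣? r) ×-dec (d ∣? ∣ k ∣)) term (oneTo r) ⟩
    sumℤ (map (λ d → ⟦ (d ∣? r) ×-dec (d ∣? ∣ k ∣) ⟧ *ℤ term d) (oneTo r))
      ≡⟨ sumℤ-map-oneTo _ r ⟩
    ∑ r (λ i → ⟦ (suc i ∣? r) ×-dec (suc i ∣? ∣ k ∣) ⟧ *ℤ term (suc i))
      ≡⟨ ∑-cong r (λ i → trans (cong (_*ℤ term (suc i)) (⟦⟧-×-dec (suc i ∣? r) (suc i ∣? ∣ k ∣)))
                               (ℤP.*-assoc ⟦ suc i ∣? r ⟧ ⟦ suc i ∣? ∣ k ∣ ⟧ (term (suc i)))) ⟩
    ∑ r (λ i → ⟦ suc i ∣? r ⟧ *ℤ (⟦ suc i ∣? ∣ k ∣ ⟧ *ℤ term (suc i)))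
      ≡⟨ sym (∑∣≡∑-positive r (λ d → ⟦ d ∣? ∣ k ∣ ⟧ *ℤ term d) r≥1) ⟩
    ∑∣ r (λ d → ⟦ d ∣? ∣ k ∣ ⟧ *ℤ term d) ∎
    where
    open ≡-Reasoning
    term : ℕ → ℤ
    term d = μ (r div d) *ℤ + d

  ∑∣-complement : ∀ r F → 1 ≤ r → ∑∣ r (λ e → F (r div e)) ≡ ∑∣ r F
  ∑∣-complement r F r≥1 =
    ∑-reindex (_∣? r) (_∣? r) (suc r) (suc r) (r div_) (r div_)
      (λ _ e∣r → s≤s (∣-pos⇒≤ r≥1 e∣r)) (λ _ e∣r → s≤s (∣-pos⇒≤ r≥1 e∣r))
      (λ _ → div-∣ r≥1) (λ _ → div-∣ r≥1)
      (λ _ → div-involutive r≥1) (λ _ → div-involutive r≥1) F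

  c-∣∣ : ∀ r k k′ → ∣ k ∣ ≡ ∣ k′ ∣ → c r k ≡ c r k′
  c-∣∣ r k k′ ∣k∣≡∣k′∣ =
    cong (λ n → sumℤ (map (λ d → μ (r div d) *ℤ + d) (filter (λ d → (d ∣? r) ×-dec (d ∣? n)) (oneTo r)))) ∣k∣≡∣k′∣

  -- For a prime p ∣ r/d, the divisors e with p ∤ r/e cancel against e/p (μ changes sign,
  -- gcd(d, e) does not change), and those with p² ∣ r/e have μ(r/e) = 0.
  module _ (r d : ℕ) (G : ℕ → ℤ) (r≥1 : 1 ≤ r) (d∣r : d ∣ r) (d≢r : d ≢ r) where

    private
      d≥1 : 1 ≤ d
      d≥1 = ∣-pos⇒pos r≥1 d∣r

      r/d≥2 : 2 ≤ r div d
      r/d≥2 with r div d | m∣n⇒n≡n-div-m*m d∣r d≥1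
      ... | 0 | r≡0 = ⊥-elim (<⇒≢ r≥1 (sym r≡0))
      ... | 1 | r≡1*d = ⊥-elim (d≢r (sym (trans r≡1*d (*-identityˡ d))))
      ... | suc (suc _) | _ = s≤s (s≤s z≤n)

      p : ℕ
      p = proj₁ (∃primeFactor (r div d) r/d≥2)

      p-prime : Prime p
      p-prime = proj₁ (proj₂ (∃primeFactor (r div d) r/d≥2))

      p∣r/d : p ∣ r div d
      p∣r/d = proj₂ (proj₂ (∃primeFactor (r div d) r/d≥2))

      instance
        p≢0 : NonZero p
        p≢0 = >-nonZero (prime⇒pos p-prime)

      p*d∣r : p * d ∣ r
      p*d∣r = subst (p * d ∣_) (sym (m∣n⇒n≡n-div-m*m d∣r d≥1)) (*-monoˡ-∣ d p∣r/d)

      V : ℕ → ℤ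
      V e = μ (r div e) *ℤ G (gcd d e)

      Unpaired? : (e : ℕ) → Dec (e ∣ r × ¬ (p ∣ r div e))
      Unpaired? e = (e ∣? r) ×-dec ¬? (p ∣? r div e)

      Paired? : (e : ℕ) → Dec (e ∣ r × (p ∣ r div e) × ¬ (p * p ∣ r div e))
      Paired? e = (e ∣? r) ×-dec ((p ∣? r div e) ×-dec ¬? ((p * p) ∣? r div e))

      split : ∀ e → ⟦ e ∣? r ⟧ *ℤ V e ≡ ⟦ Unpaired? e ⟧ *ℤ V e +ℤ ⟦ Paired? e ⟧ *ℤ V e
      split e with e ∣? r | p ∣? r div e | (p * p) ∣? r div e
      ... | no _    | _     | _     = sym (cong₂ _+ℤ_ (ℤP.*-zeroˡ (V e)) (ℤP.*-zeroˡ (V e)))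
      ... | yes _   | no _  | _     = sym (trans (cong (1ℤ *ℤ V e +ℤ_) (ℤP.*-zeroˡ (V e))) (ℤP.+-identityʳ _))
      ... | yes _   | yes _ | no _  = sym (trans (cong (_+ℤ 1ℤ *ℤ V e) (ℤP.*-zeroˡ (V e))) (ℤP.+-identityˡ _))
      ... | yes e∣r | yes _ | yes p²∣r/e =
        trans (cong (1ℤ *ℤ_) V≡0) (sym (cong₂ _+ℤ_ (ℤP.*-zeroˡ (V e)) (ℤP.*-zeroˡ (V e))))
        where
        V≡0 : V e ≡ 0ℤ
        V≡0 = trans (cong (_*ℤ G (gcd d e)) (μ-square (r div e) p (div-pos r≥1 e∣r) p-prime p²∣r/e))
                    (ℤP.*-zeroˡ (G (gcd d e)))

      module Partner (e : ℕ) (e∣r : e ∣ r) (p∤r/e : ¬ (p ∣ r div e)) where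
        e≥1 : 1 ≤ e
        e≥1 = ∣-pos⇒pos r≥1 e∣r

        r≡[r/e]*e : r ≡ (r div e) * e
        r≡[r/e]*e = m∣n⇒n≡n-div-m*m e∣r e≥1

        p∣e : p ∣ e
        p∣e = prime∣*∤ˡ⇒∣ʳ p-prime (subst (p ∣_) r≡[r/e]*e (∣-trans (m∣m*n d) p*d∣r)) p∤r/e

        e′ : ℕ
        e′ = e div p

        e≡e′*p : e ≡ e′ * p
        e≡e′*p = m∣n⇒n≡n-div-m*m p∣e (prime⇒pos p-prime)

        e′∣r : e′ ∣ r
        e′∣r = ∣-trans (divides p (trans e≡e′*p (*-comm e′ p))) e∣r

        r/e′≡p*r/e : r div e′ ≡ p * (r div e)
        r/e′≡p*r/e =
          trans (cong (_div e′) (trans r≡[r/e]*e (trans (cong ((r div e) *_) e≡e′*p) (reassoc (r div e) e′ p))))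
                (m*n-div-n≡m (p * (r div e)) e′ (∣-pos⇒pos r≥1 e′∣r))
          where
          reassoc : ∀ a b c → a * (b * c) ≡ (c * a) * b
          reassoc = solve-∀

        p*e′≡e : p * e′ ≡ e
        p*e′≡e = trans (*-comm p e′) (sym e≡e′*p)

        is-paired : e′ ∣ r × (p ∣ r div e′) × ¬ (p * p ∣ r div e′)
        is-paired = e′∣r , subst (p ∣_) (sym r/e′≡p*r/e) (m∣m*n (r div e)) ,
                    (λ p²∣ → p∤r/e (*-cancelˡ-∣ p (subst (p * p ∣_) r/e′≡p*r/e p²∣)))

        -- The p-part of gcd(d, e) is at most that of d, which is smaller than that of e.
        gcd∣e′ : gcd d e ∣ e′
        gcd∣e′ = divides w′ (*-cancelʳ-≡ e′ (w′ * g) p e′p≡w′gp)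
          where
          g : ℕ
          g = gcd d e
          g∣e : g ∣ e
          g∣e = gcd[m,n]∣n d e
          w : ℕ
          w = quotient g∣e
          instance
            g≢0 : NonZero g
            g≢0 = >-nonZero (∣-pos⇒pos e≥1 g∣e)
          r≡[r/e*w]*g : r ≡ ((r div e) * w) * g
          r≡[r/e*w]*g = trans r≡[r/e]*e (trans (cong ((r div e) *_) (m∣n⇒n≡quotient*m g∣e)) (sym (*-assoc (r div e) w g)))
          p∣w : p ∣ w
          p∣w = prime∣*∤ˡ⇒∣ʳ p-prime
                  (*-cancelʳ-∣ g (subst (p * g ∣_) r≡[r/e*w]*g (∣-trans (*-monoʳ-∣ p (gcd[m,n]∣m d e)) p*d∣r)))
                  p∤r/e
          w′ : ℕ
          w′ = quotient p∣w
          e′p≡w′gp : e′ * p ≡ (w′ * g) * p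
          e′p≡w′gp = trans (sym e≡e′*p) (trans (m∣n⇒n≡quotient*m g∣e)
                       (trans (cong (_* g) (m∣n⇒n≡quotient*m p∣w)) (reorder w′ p g)))
            where
            reorder : ∀ a b c → (a * b) * c ≡ (a * c) * b
            reorder = solve-∀

        gcd-d-e′≡gcd-d-e : gcd d e′ ≡ gcd d e
        gcd-d-e′≡gcd-d-e =
          ∣-antisym (gcd-greatest (gcd[m,n]∣m d e′) (∣-trans (gcd[m,n]∣n d e′) (divides p (trans e≡e′*p (*-comm e′ p)))))
                    (gcd-greatest (gcd[m,n]∣m d e) gcd∣e′)

        cancel : V e +ℤ V e′ ≡ 0ℤ
        cancel = begin
          V e +ℤ μ (r div e′) *ℤ G (gcd d e′)
            ≡⟨ cong₂ (λ m n → V e +ℤ μ m *ℤ G n) r/e′≡p*r/e gcd-d-e′≡gcd-d-e ⟩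
          V e +ℤ μ (p * (r div e)) *ℤ G (gcd d e)
            ≡⟨ cong (λ m → V e +ℤ m *ℤ G (gcd d e)) (μ-prime-* p (r div e) p-prime p∤r/e (div-pos r≥1 e∣r)) ⟩
          V e +ℤ -ℤ μ (r div e) *ℤ G (gcd d e)
            ≡⟨ cong (V e +ℤ_) (sym (ℤP.neg-distribˡ-* (μ (r div e)) (G (gcd d e)))) ⟩
          V e +ℤ -ℤ V e
            ≡⟨ ℤP.+-inverseʳ (V e) ⟩
          0ℤ ∎
          where open ≡-Reasoning

      partner-inverse : ∀ e → e ∣ r × (p ∣ r div e) × ¬ (p * p ∣ r div e) → p * e ∣ r × ¬ (p ∣ r div (p * e))
      partner-inverse e (e∣r , p∣r/e , p²∤r/e) = divides w r≡w*pe ,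
        (λ p∣r/pe → p²∤r/e (subst (p * p ∣_) (sym r/e≡w*p) (*-monoˡ-∣ p (subst (p ∣_) r/pe≡w p∣r/pe))))
        where
        w : ℕ
        w = quotient p∣r/e
        r/e≡w*p : r div e ≡ w * p
        r/e≡w*p = m∣n⇒n≡quotient*m p∣r/e
        r≡w*pe : r ≡ w * (p * e)
        r≡w*pe = trans (m∣n⇒n≡n-div-m*m e∣r (∣-pos⇒pos r≥1 e∣r)) (trans (cong (_* e) r/e≡w*p) (*-assoc w p e))
        r/pe≡w : r div (p * e) ≡ w
        r/pe≡w = trans (cong (_div (p * e)) r≡w*pe) (m*n-div-n≡m w (p * e) (*-mono-≤ (prime⇒pos p-prime) (∣-pos⇒pos r≥1 e∣r)))

      pairing : ∑ (suc r) (λ e → ⟦ Unpaired? e ⟧ *ℤ V (e div p)) ≡ ∑ (suc r) (λ e → ⟦ Paired? e ⟧ *ℤ V e)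
      pairing = ∑-reindex Unpaired? Paired? (suc r) (suc r) (_div p) (p *_)
        (λ _ (e∣r , _) → s≤s (∣-pos⇒≤ r≥1 e∣r)) (λ _ (e∣r , _) → s≤s (∣-pos⇒≤ r≥1 e∣r))
        (λ e (e∣r , p∤r/e) → Partner.is-paired e e∣r p∤r/e) partner-inverse
        (λ e (e∣r , p∤r/e) → Partner.p*e′≡e e e∣r p∤r/e) (λ e _ → n*m-div-n≡m p e (prime⇒pos p-prime)) V

    ∑∣μ-gcd≡0 : ∑∣ r (λ e → μ (r div e) *ℤ G (gcd d e)) ≡ 0ℤ
    ∑∣μ-gcd≡0 = begin
      ∑∣ r V
        ≡⟨ trans (∑-cong (suc r) split) (∑-distrib-+ (suc r) (λ e → ⟦ Unpaired? e ⟧ *ℤ V e) (λ e → ⟦ Paired? e ⟧ *ℤ V e)) ⟩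
      ∑ (suc r) (λ e → ⟦ Unpaired? e ⟧ *ℤ V e) +ℤ ∑ (suc r) (λ e → ⟦ Paired? e ⟧ *ℤ V e)
        ≡⟨ cong (∑ (suc r) (λ e → ⟦ Unpaired? e ⟧ *ℤ V e) +ℤ_) (sym pairing) ⟩
      ∑ (suc r) (λ e → ⟦ Unpaired? e ⟧ *ℤ V e) +ℤ ∑ (suc r) (λ e → ⟦ Unpaired? e ⟧ *ℤ V (e div p))
        ≡⟨ sym (∑-distrib-+ (suc r) (λ e → ⟦ Unpaired? e ⟧ *ℤ V e) (λ e → ⟦ Unpaired? e ⟧ *ℤ V (e div p))) ⟩
      ∑ (suc r) (λ e → ⟦ Unpaired? e ⟧ *ℤ V e +ℤ ⟦ Unpaired? e ⟧ *ℤ V (e div p))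
        ≡⟨ ∑-zero (suc r) (λ e _ → trans (sym (ℤP.*-distribˡ-+ ⟦ Unpaired? e ⟧ (V e) _))
                                         (⟦⟧-*-zero (Unpaired? e) (λ (e∣r , p∤r/e) → Partner.cancel e e∣r p∤r/e))) ⟩
      0ℤ ∎
      where open ≡-Reasoning

  ∑∣μ≡[n≡1] : ∀ n → 1 ≤ n → ∑∣ n μ ≡ ⟦ n ≟ 1 ⟧
  ∑∣μ≡[n≡1] 1 _ = refl
  ∑∣μ≡[n≡1] n@(suc (suc _)) n≥1 = begin
    ∑∣ n μ                          ≡⟨ sym (∑∣-complement n μ n≥1) ⟩
    ∑∣ n (λ e → μ (n div e))        ≡⟨ ∑∣-cong n (λ e _ → sym (ℤP.*-identityʳ (μ (n div e)))) ⟩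
    ∑∣ n (λ e → μ (n div e) *ℤ 1ℤ)  ≡⟨ ∑∣μ-gcd≡0 n 1 (λ _ → 1ℤ) n≥1 (1∣ n) (λ ()) ⟩
    0ℤ                              ∎
    where open ≡-Reasoning

  [coprime]≡∑∣μ : ∀ r b → 1 ≤ r → ⟦ gcd b r ≟ 1 ⟧ ≡ ∑∣ r (λ e → ⟦ e ∣? b ⟧ *ℤ μ e)
  [coprime]≡∑∣μ r b r≥1 = sym (begin
    ∑∣ r (λ e → ⟦ e ∣? b ⟧ *ℤ μ e)
      ≡⟨ ∑-cong (suc r) (λ e → sym (trans (cong (_*ℤ μ e) (⟦⟧-×-dec (e ∣? r) (e ∣? b)))
                                          (ℤP.*-assoc ⟦ e ∣? r ⟧ ⟦ e ∣? b ⟧ (μ e)))) ⟩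
    ∑ (suc r) (λ e → ⟦ (e ∣? r) ×-dec (e ∣? b) ⟧ *ℤ μ e)
      ≡⟨ ∑-reindex (λ e → (e ∣? r) ×-dec (e ∣? b)) (_∣? g) (suc r) (suc g) (λ e → e) (λ e → e)
           (λ _ (e∣r , _) → s≤s (∣-pos⇒≤ r≥1 e∣r)) (λ _ e∣g → s≤s (∣-pos⇒≤ g≥1 e∣g))
           (λ _ (e∣r , e∣b) → gcd-greatest e∣b e∣r) (λ _ e∣g → ∣-trans e∣g (gcd[m,n]∣n b r) , ∣-trans e∣g (gcd[m,n]∣m b r))
           (λ _ _ → refl) (λ _ _ → refl) μ ⟩
    ∑∣ g μ
      ≡⟨ ∑∣μ≡[n≡1] g g≥1 ⟩
    ⟦ g ≟ 1 ⟧ ∎)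
    where
    open ≡-Reasoning
    g : ℕ
    g = gcd b r
    g≥1 : 1 ≤ g
    g≥1 = ∣-pos⇒pos r≥1 (gcd[m,n]∣n b r)

  ∑[e∣1+i]≡r/e : ∀ r e → 1 ≤ e → e ∣ r → ∑ r (λ i → ⟦ e ∣? suc i ⟧) ≡ + (r div e)
  ∑[e∣1+i]≡r/e r e e≥1 e∣r =
    trans (∑-cong r (λ i → cong (λ n → ⟦ e ∣? n ⟧) (sym (+-comm i 1)))) (∑[L∣a-a₀]≡r/L r e ℤ.-1ℤ e≥1 e∣r)

  φ≡∑∣ : ∀ r → 1 ≤ r → + φ r ≡ ∑∣ r (λ d → μ (r div d) *ℤ + d)
  φ≡∑∣ r r≥1 = begin
    + φ r
      ≡⟨ trans (length-filter (λ b → gcd b r ≟ 1) (oneTo r)) (sumℤ-map-oneTo _ r) ⟩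
    ∑ r (λ i → ⟦ gcd (suc i) r ≟ 1 ⟧)
      ≡⟨ ∑-cong r (λ i → [coprime]≡∑∣μ r (suc i) r≥1) ⟩
    ∑ r (λ i → ∑∣ r (λ e → ⟦ e ∣? suc i ⟧ *ℤ μ e))
      ≡⟨ ∑-comm r (suc r) (λ i e → ⟦ e ∣? r ⟧ *ℤ (⟦ e ∣? suc i ⟧ *ℤ μ e)) ⟩
    ∑ (suc r) (λ e → ∑ r (λ i → ⟦ e ∣? r ⟧ *ℤ (⟦ e ∣? suc i ⟧ *ℤ μ e)))
      ≡⟨ ∑-cong (suc r) (λ e → trans (∑-cong r (λ i → reorder ⟦ e ∣? r ⟧ ⟦ e ∣? suc i ⟧ (μ e)))
                                       (trans (∑-*ˡ r (⟦ e ∣? r ⟧ *ℤ μ e) (λ i → ⟦ e ∣? suc i ⟧))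
                                              (ℤP.*-assoc ⟦ e ∣? r ⟧ (μ e) (∑ r (λ i → ⟦ e ∣? suc i ⟧))))) ⟩
    ∑∣ r (λ e → μ e *ℤ ∑ r (λ i → ⟦ e ∣? suc i ⟧))
      ≡⟨ ∑∣-cong r (λ e e∣r → cong (μ e *ℤ_) (∑[e∣1+i]≡r/e r e (∣-pos⇒pos r≥1 e∣r) e∣r)) ⟩
    ∑∣ r (λ e → μ e *ℤ + (r div e))
      ≡⟨ ∑∣-cong r (λ e e∣r → cong (λ n → μ n *ℤ + (r div e)) (sym (div-involutive r≥1 e∣r))) ⟩
    ∑∣ r (λ e → μ (r div (r div e)) *ℤ + (r div e))
      ≡⟨ ∑∣-complement r (λ d → μ (r div d) *ℤ + d) r≥1 ⟩
    ∑∣ r (λ d → μ (r div d) *ℤ + d) ∎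
    where
    open ≡-Reasoning
    reorder : ∀ x y z → x *ℤ (y *ℤ z) ≡ (x *ℤ z) *ℤ y
    reorder = solve-∀ℤ

  c[r,0]≡φ : ∀ r → 1 ≤ r → c r 0ℤ ≡ + φ r
  c[r,0]≡φ r r≥1 =
    trans (c≡∑∣ r 0ℤ r≥1)
      (trans (∑∣-cong r (λ d _ → trans (cong (_*ℤ (μ (r div d) *ℤ + d)) (⟦⟧-yes (d ∣? 0) (d ∣0))) (ℤP.*-identityˡ _)))
             (sym (φ≡∑∣ r r≥1)))

  c-congruent : ∀ r x y → 1 ≤ r → + r ∣ℤ x ℤ.- y → c r x ≡ c r y
  c-congruent r x y r≥1 r∣x-y =
    trans (c≡∑∣ r x r≥1)
      (trans (∑∣-cong r (λ d d∣r → cong (_*ℤ (μ (r div d) *ℤ + d))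
                                      (⟦∣∣⟧-congruent d x y (Signed.∣-trans (∣∣⇒∣ℤ (+ r) d∣r) r∣x-y))))
             (sym (c≡∑∣ r y r≥1)))


module Orthogonality where

  open import Data.Nat as ℕ using (ℕ; suc; _≤_)
  open import Data.Nat.Properties using (*-identityˡ; n<1+n)
  open import Data.Nat.Divisibility
  open import Data.Nat.GCD
  open import Data.Integer using (ℤ; +_; 1ℤ; ∣_∣; _+_; _*_; _-_)
  import Data.Integer.Properties as ℤP
  open import Data.Integer.Tactic.RingSolver using (solve-∀)
  open import Relation.Binary.PropositionalEquality
  open import Defs using (μ; c; _div_)
  open FiniteSums
  open Arithmetic
  open Congruences
  open RamanujanSum

  module _ (r : ℕ) (x y : ℤ) (r≥1 : 1 ≤ r) where

    private
      I : ℕ → ℤ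
      I d = ⟦ d ∣? r ⟧

      μ′ : ℕ → ℤ
      μ′ d = μ (r div d)

      term : ℤ → ℕ → ℤ
      term k d = ⟦ d ∣? ∣ k ∣ ⟧ * (μ′ d * + d)

      H : ℕ → ℤ
      H g = ⟦ g ∣? ∣ x - y ∣ ⟧ * + g

      solutions : ℕ → ℕ → ℕ → ℤ
      solutions d e a = ⟦ d ∣? ∣ x - + a ∣ ⟧ * ⟦ e ∣? ∣ + a - y ∣ ⟧

      summand : ℕ → ℕ → ℕ → ℤ
      summand d e a = (I d * term (x - + a) d) * (I e * term (+ a - y) e)

      expand : ∑ r (λ a → c r (x - + a) * c r (+ a - y)) ≡ ∑ (suc r) (λ d → ∑ (suc r) (λ e → ∑ r (summand d e)))
      expand = begin
        ∑ r (λ a → c r (x - + a) * c r (+ a - y))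
          ≡⟨ ∑-cong r (λ a → trans (cong₂ _*_ (c≡∑∣ r (x - + a) r≥1) (c≡∑∣ r (+ a - y) r≥1))
                                   (∑*∑ (suc r) (suc r) (λ d → I d * term (x - + a) d) (λ e → I e * term (+ a - y) e))) ⟩
        ∑ r (λ a → ∑ (suc r) (λ d → ∑ (suc r) (λ e → summand d e a)))
          ≡⟨ ∑-comm r (suc r) (λ a d → ∑ (suc r) (λ e → summand d e a)) ⟩
        ∑ (suc r) (λ d → ∑ r (λ a → ∑ (suc r) (λ e → summand d e a)))
          ≡⟨ ∑-cong (suc r) (λ d → ∑-comm r (suc r) (λ a e → summand d e a)) ⟩
        ∑ (suc r) (λ d → ∑ (suc r) (λ e → ∑ r (summand d e))) ∎
        where open ≡-Reasoning

      weight : ℕ → ℕ → ℤ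
      weight d e = I d * (μ′ d * (I e * (μ′ e * H (gcd d e))))

      count : ∀ d e → ∑ r (summand d e) ≡ + r * weight d e
      count d e = begin
        ∑ r (summand d e)
          ≡⟨ ∑-cong r (λ a → collect (I d) (I e) ⟦ d ∣? ∣ x - + a ∣ ⟧ ⟦ e ∣? ∣ + a - y ∣ ⟧ (μ′ d) (μ′ e) (+ d) (+ e)) ⟩
        ∑ r (λ a → K * solutions d e a)
          ≡⟨ ∑-*ˡ r K (solutions d e) ⟩
        K * ∑ r (solutions d e)
          ≡⟨ separate (I d) (I e) (μ′ d) (μ′ e) (+ d) (+ e) (∑ r (solutions d e)) ⟩
        I d * (I e * ((μ′ d * μ′ e) * (+ d * (+ e * ∑ r (solutions d e)))))
          ≡⟨ ⟦⟧-* (d ∣? r) (λ d∣r → ⟦⟧-* (e ∣? r) (λ e∣r →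
               cong (_*_ (μ′ d * μ′ e)) (∑[d∣x-a][e∣a-y] r d e x y r≥1 d∣r e∣r))) ⟩
        I d * (I e * ((μ′ d * μ′ e) * (+ r * H (gcd d e))))
          ≡⟨ factor-r (I d) (I e) (μ′ d) (μ′ e) (+ r) (H (gcd d e)) ⟩
        + r * (I d * (μ′ d * (I e * (μ′ e * H (gcd d e))))) ∎
        where
        open ≡-Reasoning
        K : ℤ
        K = ((I d * I e) * (μ′ d * μ′ e)) * (+ d * + e)
        collect : ∀ i j s t m n a b → (i * (s * (m * a))) * (j * (t * (n * b))) ≡ (((i * j) * (m * n)) * (a * b)) * (s * t)
        collect = solve-∀
        separate : ∀ i j m n a b s → (((i * j) * (m * n)) * (a * b)) * s ≡ i * (j * ((m * n) * (a * (b * s))))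
        separate = solve-∀
        factor-r : ∀ i j m n r h → i * (j * ((m * n) * (r * h))) ≡ r * (i * (m * (j * (n * h))))
        factor-r = solve-∀

      r-div-r≡1 : r div r ≡ 1
      r-div-r≡1 = trans (cong (_div r) (sym (*-identityˡ r))) (m*n-div-n≡m 1 r r≥1)

      only-d≡r : ∑∣ r (λ d → μ′ d * ∑∣ r (λ e → μ′ e * H (gcd d e))) ≡ c r (x - y)
      only-d≡r = begin
        ∑∣ r (λ d → μ′ d * ∑∣ r (λ e → μ′ e * H (gcd d e)))
          ≡⟨ ∑-single (suc r) _ r (n<1+n r) (λ d _ d≢r → ⟦⟧-*-zero (d ∣? r) (λ d∣r →
               trans (cong (_*_ (μ′ d)) (∑∣μ-gcd≡0 r d H r≥1 d∣r d≢r)) (ℤP.*-zeroʳ (μ′ d)))) ⟩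
        I r * (μ′ r * ∑∣ r (λ e → μ′ e * H (gcd r e)))
          ≡⟨ cong₂ (λ i m → i * (μ m * ∑∣ r (λ e → μ′ e * H (gcd r e)))) (⟦⟧-yes (r ∣? r) ∣-refl) r-div-r≡1 ⟩
        1ℤ * (1ℤ * ∑∣ r (λ e → μ′ e * H (gcd r e)))
          ≡⟨ trans (ℤP.*-identityˡ _) (ℤP.*-identityˡ _) ⟩
        ∑∣ r (λ e → μ′ e * H (gcd r e))
          ≡⟨ ∑∣-cong r (λ e e∣r → trans (cong (λ g → μ′ e * H g) (∣-antisym (gcd[m,n]∣n r e) (gcd-greatest e∣r ∣-refl)))
                                         (swap (μ′ e) ⟦ e ∣? ∣ x - y ∣ ⟧ (+ e))) ⟩
        ∑∣ r (term (x - y))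
          ≡⟨ sym (c≡∑∣ r (x - y) r≥1) ⟩
        c r (x - y) ∎
        where
        open ≡-Reasoning
        swap : ∀ m i e → m * (i * e) ≡ i * (m * e)
        swap = solve-∀

    c-convolution : ∑ r (λ a → c r (x - + a) * c r (+ a - y)) ≡ + r * c r (x - y)
    c-convolution = begin
      ∑ r (λ a → c r (x - + a) * c r (+ a - y))
        ≡⟨ expand ⟩
      ∑ (suc r) (λ d → ∑ (suc r) (λ e → ∑ r (summand d e)))
        ≡⟨ ∑-cong (suc r) (λ d → trans (∑-cong (suc r) (count d)) (∑-*ˡ (suc r) (+ r) (weight d))) ⟩
      ∑ (suc r) (λ d → + r * ∑ (suc r) (weight d))
        ≡⟨ ∑-*ˡ (suc r) (+ r) (λ d → ∑ (suc r) (weight d)) ⟩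
      + r * ∑ (suc r) (λ d → ∑ (suc r) (weight d))
        ≡⟨ cong (_*_ (+ r)) (∑-cong (suc r) (λ d →
             trans (∑-*ˡ (suc r) (I d) (λ e → μ′ d * (I e * (μ′ e * H (gcd d e)))))
                   (cong (_*_ (I d)) (∑-*ˡ (suc r) (μ′ d) (λ e → I e * (μ′ e * H (gcd d e))))))) ⟩
      + r * ∑∣ r (λ d → μ′ d * ∑∣ r (λ e → μ′ e * H (gcd d e)))
        ≡⟨ cong (_*_ (+ r)) only-d≡r ⟩
      + r * c r (x - y) ∎
      where open ≡-Reasoning


module Multiplicativity where

  open import Data.Nat as ℕ using (ℕ; suc; s≤s; _≤_) renaming (_*_ to _*ℕ_)
  import Data.Nat.Properties as ℕP
  open import Data.Nat.Divisibility
  open import Data.Nat.GCD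
  open import Data.Nat.Coprimality using (Coprime; coprime-divisor)
  import Data.Nat.Tactic.RingSolver as ℕ-Solver
  open import Data.Integer using (ℤ; +_; ∣_∣; _*_)
  import Data.Integer.Properties as ℤP
  open import Data.Integer.Tactic.RingSolver using (solve-∀)
  open import Data.Product using (_,_; _×_)
  open import Relation.Binary.PropositionalEquality
  open import Relation.Nullary using (Dec)
  open import Relation.Nullary.Decidable using (_×-dec_)
  open import Defs using (μ; c; _div_)
  open FiniteSums
  open Reindexing
  open Arithmetic
  open Möbius
  open RamanujanSum

  gcd[d,m]*gcd[d,n]≡d : ∀ {d m n} → Coprime m n → d ∣ m *ℕ n → gcd d m *ℕ gcd d n ≡ d
  gcd[d,m]*gcd[d,n]≡d {d} {m} {n} coprime d∣mn = ∣-antisym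
    (coprime-∣-∣⇒*∣ (coprime-∣-∣ coprime (gcd[m,n]∣n d m) (gcd[m,n]∣n d n)) (gcd[m,n]∣m d m) (gcd[m,n]∣m d n))
    (subst (d ∣_) (sym (c*gcd[m,n]≡gcd[cm,cn] (gcd d m) d n)) (gcd-greatest (n∣m*n (gcd d m)) d∣gcd[d,m]*n))
    where
    d∣gcd[d,m]*n : d ∣ gcd d m *ℕ n
    d∣gcd[d,m]*n = subst (d ∣_) (trans (sym (c*gcd[m,n]≡gcd[cm,cn] n d m)) (ℕP.*-comm n (gcd d m)))
                         (gcd-greatest (n∣m*n n) (subst (d ∣_) (ℕP.*-comm m n) d∣mn))

  gcd[d*e,m]≡d : ∀ {d e m n} → Coprime m n → d ∣ m → e ∣ n → gcd (d *ℕ e) m ≡ d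
  gcd[d*e,m]≡d {d} {e} {m} coprime d∣m e∣n = ∣-antisym
    (coprime-divisor (coprime-∣-∣ coprime (gcd[m,n]∣n (d *ℕ e) m) e∣n)
                     (subst (gcd (d *ℕ e) m ∣_) (ℕP.*-comm d e) (gcd[m,n]∣m (d *ℕ e) m)))
    (gcd-greatest (m∣m*n e) d∣m)

  module _ (m n : ℕ) (k : ℤ) (m≥1 : 1 ≤ m) (n≥1 : 1 ≤ n) (coprime : Coprime m n) where

    private
      term : ℕ → ℕ → ℤ
      term r d = ⟦ d ∣? ∣ k ∣ ⟧ * (μ (r div d) * + d)

      divides-both? : (d e : ℕ) → Dec ((d ∣ m) × (e ∣ n))
      divides-both? d e = (d ∣? m) ×-dec (e ∣? n)

      m*n-div-d*e : ∀ {d e} → d ∣ m → e ∣ n → (m *ℕ n) div (d *ℕ e) ≡ (m div d) *ℕ (n div e)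
      m*n-div-d*e {d} {e} d∣m e∣n =
        trans (cong (_div (d *ℕ e)) (trans (cong₂ _*ℕ_ (m∣n⇒n≡n-div-m*m d∣m d≥1) (m∣n⇒n≡n-div-m*m e∣n e≥1))
                                           (interchange (m div d) d (n div e) e)))
              (m*n-div-n≡m ((m div d) *ℕ (n div e)) (d *ℕ e) (ℕP.*-mono-≤ d≥1 e≥1))
        where
        d≥1 : 1 ≤ d
        d≥1 = ∣-pos⇒pos m≥1 d∣m
        e≥1 : 1 ≤ e
        e≥1 = ∣-pos⇒pos n≥1 e∣n
        interchange : ∀ a b c d → (a *ℕ b) *ℕ (c *ℕ d) ≡ (a *ℕ c) *ℕ (b *ℕ d)
        interchange = ℕ-Solver.solve-∀

      term-* : ∀ d e → d ∣ m → e ∣ n → term m d * term n e ≡ term (m *ℕ n) (d *ℕ e)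
      term-* d e d∣m e∣n = begin
        (⟦ d ∣? ∣ k ∣ ⟧ * (μ (m div d) * + d)) * (⟦ e ∣? ∣ k ∣ ⟧ * (μ (n div e) * + e))
          ≡⟨ interchange ⟦ d ∣? ∣ k ∣ ⟧ ⟦ e ∣? ∣ k ∣ ⟧ (μ (m div d)) (μ (n div e)) (+ d) (+ e) ⟩
        (⟦ d ∣? ∣ k ∣ ⟧ * ⟦ e ∣? ∣ k ∣ ⟧) * ((μ (m div d) * μ (n div e)) * (+ d * + e))
          ≡⟨ cong₂ (λ i t → i * t) [d∣k]*[e∣k]≡[de∣k]
               (cong₂ _*_ (sym (μ-multiplicative (m div d) (n div e) (div-pos m≥1 d∣m) (div-pos n≥1 e∣n)
                                   (coprime-∣-∣ coprime (div-∣ m≥1 d∣m) (div-∣ n≥1 e∣n))))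
                          (sym (ℤP.pos-* d e))) ⟩
        ⟦ (d *ℕ e) ∣? ∣ k ∣ ⟧ * (μ ((m div d) *ℕ (n div e)) * + (d *ℕ e))
          ≡⟨ cong (λ q → ⟦ (d *ℕ e) ∣? ∣ k ∣ ⟧ * (μ q * + (d *ℕ e))) (sym (m*n-div-d*e d∣m e∣n)) ⟩
        term (m *ℕ n) (d *ℕ e) ∎
        where
        open ≡-Reasoning
        interchange : ∀ i j s t a b → (i * (s * a)) * (j * (t * b)) ≡ (i * j) * ((s * t) * (a * b))
        interchange = solve-∀
        [d∣k]*[e∣k]≡[de∣k] : ⟦ d ∣? ∣ k ∣ ⟧ * ⟦ e ∣? ∣ k ∣ ⟧ ≡ ⟦ (d *ℕ e) ∣? ∣ k ∣ ⟧
        [d∣k]*[e∣k]≡[de∣k] = trans (sym (⟦⟧-×-dec (d ∣? ∣ k ∣) (e ∣? ∣ k ∣)))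
          (⟦⟧-cong ((d ∣? ∣ k ∣) ×-dec (e ∣? ∣ k ∣)) ((d *ℕ e) ∣? ∣ k ∣)
            (λ (d∣k , e∣k) → coprime-∣-∣⇒*∣ (coprime-∣-∣ coprime d∣m e∣n) d∣k e∣k)
            (λ de∣k → m*n∣⇒m∣ d e de∣k , m*n∣⇒n∣ d e de∣k))

      summand-* : ∀ d e → (⟦ d ∣? m ⟧ * term m d) * (⟦ e ∣? n ⟧ * term n e) ≡ ⟦ divides-both? d e ⟧ * term (m *ℕ n) (d *ℕ e)
      summand-* d e = begin
        (⟦ d ∣? m ⟧ * term m d) * (⟦ e ∣? n ⟧ * term n e)
          ≡⟨ interchange ⟦ d ∣? m ⟧ ⟦ e ∣? n ⟧ (term m d) (term n e) ⟩
        (⟦ d ∣? m ⟧ * ⟦ e ∣? n ⟧) * (term m d * term n e)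
          ≡⟨ cong (_* (term m d * term n e)) (sym (⟦⟧-×-dec (d ∣? m) (e ∣? n))) ⟩
        ⟦ divides-both? d e ⟧ * (term m d * term n e)
          ≡⟨ ⟦⟧-* (divides-both? d e) (λ (d∣m , e∣n) → term-* d e d∣m e∣n) ⟩
        ⟦ divides-both? d e ⟧ * term (m *ℕ n) (d *ℕ e) ∎
        where
        open ≡-Reasoning
        interchange : ∀ a b u v → (a * u) * (b * v) ≡ (a * b) * (u * v)
        interchange = solve-∀

    c-multiplicative : c m k * c n k ≡ c (m *ℕ n) k
    c-multiplicative = begin
      c m k * c n k
        ≡⟨ cong₂ _*_ (c≡∑∣ m k m≥1) (c≡∑∣ n k n≥1) ⟩
      ∑∣ m (term m) * ∑∣ n (term n)
        ≡⟨ ∑*∑ (suc m) (suc n) (λ d → ⟦ d ∣? m ⟧ * term m d) (λ e → ⟦ e ∣? n ⟧ * term n e) ⟩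
      ∑ (suc m) (λ d → ∑ (suc n) (λ e → (⟦ d ∣? m ⟧ * term m d) * (⟦ e ∣? n ⟧ * term n e)))
        ≡⟨ ∑-cong (suc m) (λ d → ∑-cong (suc n) (summand-* d)) ⟩
      ∑ (suc m) (λ d → ∑ (suc n) (λ e → ⟦ divides-both? d e ⟧ * term (m *ℕ n) (d *ℕ e)))
        ≡⟨ ∑∑-reindex divides-both? (_∣? m *ℕ n) (suc m) (suc n) (suc (m *ℕ n)) _*ℕ_ (λ d → gcd d m) (λ d → gcd d n)
             (λ _ _ (d∣m , _) → s≤s (∣-pos⇒≤ m≥1 d∣m)) (λ _ _ (_ , e∣n) → s≤s (∣-pos⇒≤ n≥1 e∣n))
             (λ _ d∣mn → s≤s (∣-pos⇒≤ (ℕP.*-mono-≤ m≥1 n≥1) d∣mn))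
             (λ _ _ (d∣m , e∣n) → *-pres-∣ d∣m e∣n) (λ d _ → gcd[m,n]∣n d m , gcd[m,n]∣n d n)
             (λ _ _ (d∣m , e∣n) → gcd[d*e,m]≡d coprime d∣m e∣n)
             (λ d e (d∣m , e∣n) → trans (cong (λ x → gcd x n) (ℕP.*-comm d e))
                                        (gcd[d*e,m]≡d (Data.Nat.Coprimality.sym coprime) e∣n d∣m))
             (λ _ d∣mn → gcd[d,m]*gcd[d,n]≡d coprime d∣mn) (term (m *ℕ n)) ⟩
      ∑∣ (m *ℕ n) (term (m *ℕ n))
        ≡⟨ sym (c≡∑∣ (m *ℕ n) k (ℕP.*-mono-≤ m≥1 n≥1)) ⟩
      c (m *ℕ n) k ∎
      where open ≡-Reasoning


module HalfSums where

  open import Data.Nat as ℕ using (ℕ; suc; _≤_)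
  import Data.Nat.Properties as ℕP
  open import Data.Integer as ℤ using (ℤ; +_; -_) renaming (_+_ to _+ℤ_; _*_ to _*ℤ_)
  open import Data.Integer.Tactic.RingSolver using (solve-∀)
  open import Data.Rational as ℚ using (ℚ; ½; 0ℚ; 1ℚ; _+_; _*_; _-_; toℚᵘ)
  import Data.Rational.Properties as ℚP
  open import Data.Rational.Unnormalised as ℚᵘ using (mkℚᵘ; *≡*; _≃_)
  import Data.Rational.Unnormalised.Properties as ℚᵘP
  open import Data.Rational.Solver using (module +-*-Solver)
  open import Data.List using ([]; _∷_; map; upTo)
  open import Data.List.Properties using (map-upTo)
  open import Relation.Binary.PropositionalEquality
  open import Defs using (ℤtoℚ; inv; sumℚ; sumℤ; herm; normSq)
  open FiniteSums

  private
    toℚᵘ-ℤtoℚ : ∀ z → toℚᵘ (ℤtoℚ z) ≃ mkℚᵘ z 0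
    toℚᵘ-ℤtoℚ z = ℚP.toℚᵘ-fromℚᵘ (mkℚᵘ z 0)

  ℤtoℚ-+ : ∀ a b → ℤtoℚ (a +ℤ b) ≡ ℤtoℚ a + ℤtoℚ b
  ℤtoℚ-+ a b = ℚP.toℚᵘ-injective
    (ℚᵘP.≃-trans (toℚᵘ-ℤtoℚ (a +ℤ b))
      (ℚᵘP.≃-trans (*≡* (over-1 a b))
        (ℚᵘP.≃-trans (ℚᵘP.+-cong (ℚᵘP.≃-sym (toℚᵘ-ℤtoℚ a)) (ℚᵘP.≃-sym (toℚᵘ-ℤtoℚ b)))
          (ℚᵘP.≃-sym (ℚP.toℚᵘ-homo-+ (ℤtoℚ a) (ℤtoℚ b))))))
    where
    over-1 : ∀ a b → (a +ℤ b) *ℤ + 1 ≡ (a *ℤ + 1 +ℤ b *ℤ + 1) *ℤ + 1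
    over-1 = solve-∀

  ℤtoℚ-* : ∀ a b → ℤtoℚ (a *ℤ b) ≡ ℤtoℚ a * ℤtoℚ b
  ℤtoℚ-* a b = ℚP.toℚᵘ-injective
    (ℚᵘP.≃-trans (toℚᵘ-ℤtoℚ (a *ℤ b))
      (ℚᵘP.≃-trans (*≡* refl)
        (ℚᵘP.≃-trans (ℚᵘP.*-cong (ℚᵘP.≃-sym (toℚᵘ-ℤtoℚ a)) (ℚᵘP.≃-sym (toℚᵘ-ℤtoℚ b)))
          (ℚᵘP.≃-sym (ℚP.toℚᵘ-homo-* (ℤtoℚ a) (ℤtoℚ b))))))

  inv-*-cancel : ∀ n z → 1 ≤ n → inv n * ℤtoℚ (+ n *ℤ z) ≡ ℤtoℚ z
  inv-*-cancel (suc n) z _ = ℚP.toℚᵘ-injective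
    (ℚᵘP.≃-trans (ℚP.toℚᵘ-homo-* (inv (suc n)) (ℤtoℚ (+ suc n *ℤ z)))
      (ℚᵘP.≃-trans (ℚᵘP.*-cong (ℚP.toℚᵘ-fromℚᵘ (mkℚᵘ (+ 1) n)) (toℚᵘ-ℤtoℚ (+ suc n *ℤ z)))
        (ℚᵘP.≃-trans (*≡* (trans (cancel (+ suc n) z) (cong (λ t → z *ℤ + suc t) (sym (ℕP.*-identityʳ n)))))
          (ℚᵘP.≃-sym (toℚᵘ-ℤtoℚ z)))))
    where
    cancel : ∀ m z → (+ 1 *ℤ (m *ℤ z)) *ℤ + 1 ≡ z *ℤ m
    cancel = solve-∀

  sumℚ-scaled-ℤtoℚ : ∀ k (w : ℕ → ℤ) xs → sumℚ (map (λ n → k * ℤtoℚ (w n)) xs) ≡ k * ℤtoℚ (sumℤ (map w xs))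
  sumℚ-scaled-ℤtoℚ k w [] = sym (ℚP.*-zeroʳ k)
  sumℚ-scaled-ℤtoℚ k w (x ∷ xs) =
    trans (cong (_+_ (k * ℤtoℚ (w x))) (sumℚ-scaled-ℤtoℚ k w xs))
      (trans (sym (ℚP.*-distribˡ-+ k (ℤtoℚ (w x)) _)) (cong (k *_) (sym (ℤtoℚ-+ (w x) (sumℤ (map w xs))))))

  sumℚ-cong : ∀ {f g : ℕ → ℚ} xs → (∀ n → f n ≡ g n) → sumℚ (map f xs) ≡ sumℚ (map g xs)
  sumℚ-cong [] _ = refl
  sumℚ-cong (x ∷ xs) f≡g = cong₂ _+_ (f≡g x) (sumℚ-cong xs f≡g)

  -- All four identities are instances of Σ (θ + uρ)(θ + vρ) = q (P + (u + v) X + uv P) with u, v = ±1.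
  module EqualNorms (q : ℕ) (q≥1 : 1 ≤ q) (θ ρ : ℤ → ℤ) (P X : ℤ)
                    (θ·θ : ∑ q (λ n → θ (+ n) *ℤ θ (+ n)) ≡ + q *ℤ P)
                    (ρ·ρ : ∑ q (λ n → ρ (+ n) *ℤ ρ (+ n)) ≡ + q *ℤ P)
                    (θ·ρ : ∑ q (λ n → θ (+ n) *ℤ ρ (+ n)) ≡ + q *ℤ X) where

    private
      mix : ℤ → ℤ → ℕ → ℤ
      mix u v n = (θ (+ n) +ℤ u *ℤ ρ (+ n)) *ℤ (θ (+ n) +ℤ v *ℤ ρ (+ n))

      gram : ℤ → ℤ → ℤ
      gram u v = P +ℤ (u +ℤ v) *ℤ X +ℤ (u *ℤ v) *ℤ P

      ∑mix : ∀ u v → ∑ q (mix u v) ≡ + q *ℤ gram u v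
      ∑mix u v = begin
        ∑ q (mix u v)
          ≡⟨ ∑-cong q (λ n → expand u v (θ (+ n)) (ρ (+ n))) ⟩
        ∑ q (λ n → θθ n +ℤ ((u +ℤ v) *ℤ θρ n +ℤ (u *ℤ v) *ℤ ρρ n))
          ≡⟨ trans (∑-distrib-+ q θθ _) (cong (_+ℤ_ (∑ q θθ)) (∑-distrib-+ q _ _)) ⟩
        ∑ q θθ +ℤ (∑ q (λ n → (u +ℤ v) *ℤ θρ n) +ℤ ∑ q (λ n → (u *ℤ v) *ℤ ρρ n))
          ≡⟨ cong₂ (λ s t → ∑ q θθ +ℤ (s +ℤ t)) (∑-*ˡ q (u +ℤ v) θρ) (∑-*ˡ q (u *ℤ v) ρρ) ⟩
        ∑ q θθ +ℤ ((u +ℤ v) *ℤ ∑ q θρ +ℤ (u *ℤ v) *ℤ ∑ q ρρ)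
          ≡⟨ cong₂ (λ s t → s +ℤ ((u +ℤ v) *ℤ t +ℤ (u *ℤ v) *ℤ ∑ q ρρ)) θ·θ θ·ρ ⟩
        + q *ℤ P +ℤ ((u +ℤ v) *ℤ (+ q *ℤ X) +ℤ (u *ℤ v) *ℤ ∑ q ρρ)
          ≡⟨ cong (λ t → + q *ℤ P +ℤ ((u +ℤ v) *ℤ (+ q *ℤ X) +ℤ (u *ℤ v) *ℤ t)) ρ·ρ ⟩
        + q *ℤ P +ℤ ((u +ℤ v) *ℤ (+ q *ℤ X) +ℤ (u *ℤ v) *ℤ (+ q *ℤ P))
          ≡⟨ factor (+ q) P X u v ⟩
        + q *ℤ gram u v ∎
        where
        open ≡-Reasoning
        θθ θρ ρρ : ℕ → ℤ
        θθ n = θ (+ n) *ℤ θ (+ n)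
        θρ n = θ (+ n) *ℤ ρ (+ n)
        ρρ n = ρ (+ n) *ℤ ρ (+ n)
        expand : ∀ u v a b →
                 (a +ℤ u *ℤ b) *ℤ (a +ℤ v *ℤ b) ≡ a *ℤ a +ℤ ((u +ℤ v) *ℤ (a *ℤ b) +ℤ (u *ℤ v) *ℤ (b *ℤ b))
        expand = solve-∀
        factor : ∀ q p x u v →
                 q *ℤ p +ℤ ((u +ℤ v) *ℤ (q *ℤ x) +ℤ (u *ℤ v) *ℤ (q *ℤ p)) ≡ q *ℤ (p +ℤ (u +ℤ v) *ℤ x +ℤ (u *ℤ v) *ℤ p)
        factor = solve-∀

      ¼ : ℚ
      ¼ = ½ * ½

      ℤtoℚ-gram : ∀ u v → ℤtoℚ (gram u v) ≡ ℤtoℚ P + ℤtoℚ (u +ℤ v) * ℤtoℚ X + ℤtoℚ (u *ℤ v) * ℤtoℚ P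
      ℤtoℚ-gram u v =
        trans (ℤtoℚ-+ (P +ℤ (u +ℤ v) *ℤ X) ((u *ℤ v) *ℤ P))
          (cong₂ _+_ (trans (ℤtoℚ-+ P ((u +ℤ v) *ℤ X)) (cong (_+_ (ℤtoℚ P)) (ℤtoℚ-* (u +ℤ v) X))) (ℤtoℚ-* (u *ℤ v) P))

      herm-combination : ∀ (f g : ℚ → ℚ → ℚ) u v →
        (∀ a b → f a b * g a b ≡ ¼ * ((a + ℤtoℚ u * b) * (a + ℤtoℚ v * b))) →
        herm q (λ z → f (ℤtoℚ (θ z)) (ℤtoℚ (ρ z))) (λ z → g (ℤtoℚ (θ z)) (ℤtoℚ (ρ z)))
          ≡ ¼ * (ℤtoℚ P + ℤtoℚ (u +ℤ v) * ℤtoℚ X + ℤtoℚ (u *ℤ v) * ℤtoℚ P)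
      herm-combination f g u v f*g = begin
        inv q * sumℚ (map (λ n → F n * G n) (upTo q))
          ≡⟨ cong (inv q *_) (trans (sumℚ-cong (upTo q) F*G≡mix) (sumℚ-scaled-ℤtoℚ ¼ (mix u v) (upTo q))) ⟩
        inv q * (¼ * ℤtoℚ (sumℤ (map (mix u v) (upTo q))))
          ≡⟨ cong (λ s → inv q * (¼ * ℤtoℚ s)) (trans (cong sumℤ (map-upTo (mix u v) q)) (sumℤ-applyUpTo (mix u v) q)) ⟩
        inv q * (¼ * ℤtoℚ (∑ q (mix u v)))
          ≡⟨ cong (λ s → inv q * (¼ * ℤtoℚ s)) (∑mix u v) ⟩
        inv q * (¼ * ℤtoℚ (+ q *ℤ gram u v))
          ≡⟨ swap (inv q) ¼ (ℤtoℚ (+ q *ℤ gram u v)) ⟩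
        ¼ * (inv q * ℤtoℚ (+ q *ℤ gram u v))
          ≡⟨ cong (¼ *_) (trans (inv-*-cancel q (gram u v) q≥1) (ℤtoℚ-gram u v)) ⟩
        ¼ * (ℤtoℚ P + ℤtoℚ (u +ℤ v) * ℤtoℚ X + ℤtoℚ (u *ℤ v) * ℤtoℚ P) ∎
        where
        open ≡-Reasoning
        open +-*-Solver
        F G : ℕ → ℚ
        F n = f (ℤtoℚ (θ (+ n))) (ℤtoℚ (ρ (+ n)))
        G n = g (ℤtoℚ (θ (+ n))) (ℤtoℚ (ρ (+ n)))
        ℤtoℚ-mix : ∀ n → ℤtoℚ (mix u v n)
                       ≡ (ℤtoℚ (θ (+ n)) + ℤtoℚ u * ℤtoℚ (ρ (+ n))) * (ℤtoℚ (θ (+ n)) + ℤtoℚ v * ℤtoℚ (ρ (+ n)))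
        ℤtoℚ-mix n = trans (ℤtoℚ-* (θ (+ n) +ℤ u *ℤ ρ (+ n)) (θ (+ n) +ℤ v *ℤ ρ (+ n)))
          (cong₂ _*_ (trans (ℤtoℚ-+ (θ (+ n)) (u *ℤ ρ (+ n))) (cong (_+_ (ℤtoℚ (θ (+ n)))) (ℤtoℚ-* u (ρ (+ n)))))
                     (trans (ℤtoℚ-+ (θ (+ n)) (v *ℤ ρ (+ n))) (cong (_+_ (ℤtoℚ (θ (+ n)))) (ℤtoℚ-* v (ρ (+ n))))))
        F*G≡mix : ∀ n → F n * G n ≡ ¼ * ℤtoℚ (mix u v n)
        F*G≡mix n = trans (f*g _ _) (cong (¼ *_) (sym (ℤtoℚ-mix n)))
        swap : ∀ a b c → a * (b * c) ≡ b * (a * c)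
        swap = solve 3 (λ a b c → a :* (b :* c) := b :* (a :* c)) refl

    normSq-half-sum : normSq q (λ z → ½ * (ℤtoℚ (θ z) + ℤtoℚ (ρ z))) ≡ ½ * (ℤtoℚ P + ℤtoℚ X)
    normSq-half-sum =
      trans (herm-combination (λ a b → ½ * (a + b)) (λ a b → ½ * (a + b)) (+ 1) (+ 1)
              (solve 2 (λ a b → (con ½ :* (a :+ b)) :* (con ½ :* (a :+ b))
                                := (con ½ :* con ½) :* ((a :+ con 1ℚ :* b) :* (a :+ con 1ℚ :* b))) refl))
            (solve 2 (λ p x → (con ½ :* con ½) :* (p :+ con (ℤtoℚ (+ 2)) :* x :+ con 1ℚ :* p) := con ½ :* (p :+ x))
                   refl (ℤtoℚ P) (ℤtoℚ X))
      where open +-*-Solver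

    normSq-half-difference : normSq q (λ z → ½ * (ℤtoℚ (θ z) - ℤtoℚ (ρ z))) ≡ ½ * (ℤtoℚ P - ℤtoℚ X)
    normSq-half-difference =
      trans (herm-combination (λ a b → ½ * (a - b)) (λ a b → ½ * (a - b)) (- + 1) (- + 1)
              (solve 2 (λ a b → (con ½ :* (a :- b)) :* (con ½ :* (a :- b))
                                := (con ½ :* con ½) :* ((a :+ con (ℚ.- 1ℚ) :* b) :* (a :+ con (ℚ.- 1ℚ) :* b))) refl))
            (solve 2 (λ p x → (con ½ :* con ½) :* (p :+ con (ℤtoℚ (- + 2)) :* x :+ con 1ℚ :* p) := con ½ :* (p :- x))
                   refl (ℤtoℚ P) (ℤtoℚ X))
      where open +-*-Solver

    herm-half-sum-difference : herm q (λ z → ½ * (ℤtoℚ (θ z) + ℤtoℚ (ρ z))) (λ z → ½ * (ℤtoℚ (θ z) - ℤtoℚ (ρ z))) ≡ 0ℚ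
    herm-half-sum-difference =
      trans (herm-combination (λ a b → ½ * (a + b)) (λ a b → ½ * (a - b)) (+ 1) (- + 1)
              (solve 2 (λ a b → (con ½ :* (a :+ b)) :* (con ½ :* (a :- b))
                                := (con ½ :* con ½) :* ((a :+ con 1ℚ :* b) :* (a :+ con (ℚ.- 1ℚ) :* b))) refl))
            (solve 2 (λ p x → (con ½ :* con ½) :* (p :+ con 0ℚ :* x :+ con (ℚ.- 1ℚ) :* p) := con 0ℚ)
                   refl (ℤtoℚ P) (ℤtoℚ X))
      where open +-*-Solver

    herm-half-difference-sum : herm q (λ z → ½ * (ℤtoℚ (θ z) - ℤtoℚ (ρ z))) (λ z → ½ * (ℤtoℚ (θ z) + ℤtoℚ (ρ z))) ≡ 0ℚ
    herm-half-difference-sum =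
      trans (herm-combination (λ a b → ½ * (a - b)) (λ a b → ½ * (a + b)) (- + 1) (+ 1)
              (solve 2 (λ a b → (con ½ :* (a :- b)) :* (con ½ :* (a :+ b))
                                := (con ½ :* con ½) :* ((a :+ con (ℚ.- 1ℚ) :* b) :* (a :+ con 1ℚ :* b))) refl))
            (solve 2 (λ p x → (con ½ :* con ½) :* (p :+ con 0ℚ :* x :+ con (ℚ.- 1ℚ) :* p) := con 0ℚ)
                   refl (ℤtoℚ P) (ℤtoℚ X))
      where open +-*-Solver


open import Data.Nat as ℕ using (ℕ; _≤_; _*_)
import Data.Nat.Properties as ℕP
open import Data.Nat.Divisibility
open import Data.Nat.GCD using (gcd; gcd[m,n]∣m)
open import Data.Nat.Coprimality using (Coprime; coprime⇒gcd≡1)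
open import Data.Nat.Primality using (Prime; euclidsLemma)
open import Data.Integer as ℤ using (ℤ; +_; 0ℤ; ∣_∣) renaming (_*_ to _*ℤ_; _-_ to _-ℤ_)
import Data.Integer.Properties as ℤP
open import Data.Integer.Divisibility.Signed using () renaming (_∣_ to _∣ℤ_)
open import Data.Integer.Tactic.RingSolver using (solve-∀)
open import Data.Rational using (½; 0ℚ; _+_; _-_) renaming (_*_ to _*ℚ_)
open import Data.Product using (_,_; _×_; ∃; proj₁; proj₂)
open import Data.Sum using (inj₁; inj₂; reduce)
open import Relation.Binary.PropositionalEquality
open import Relation.Nullary using (¬_)
open import Data.Empty using (⊥)
open import Defs
open FiniteSums
open Arithmetic
open Möbius
open Congruences
open RamanujanSum
open Orthogonality
open Multiplicativity
open HalfSums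

μ²≡1⇒squarefree : ∀ n → 1 ≤ n → μ n *ℤ μ n ≡ + 1 → ∀ p → Prime p → ¬ p * p ∣ n
μ²≡1⇒squarefree n n≥1 μ²≡1 p pp p²∣n with () ← trans (sym μ²≡1) (cong (λ m → m *ℤ m) (μ-square n p n≥1 pp p²∣n))

coprime-quotient-square : ∀ {q₁ q₂ g} → 1 ≤ q₁ → (∀ p → Prime p → ¬ p * p ∣ q₁ * q₂) → g ∣ q₁ →
                          Coprime (q₁ div g) (g * (q₂ * q₂))
coprime-quotient-square {q₁} {q₂} {g} q₁≥1 squarefree g∣q₁ =
  no-common-prime⇒coprime (div-pos q₁≥1 g∣q₁) common-prime
  where
  common-prime : ∀ p → Prime p → p ∣ q₁ div g → p ∣ g * (q₂ * q₂) → ⊥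
  common-prime p pp p∣q₁/g p∣gq₂² with euclidsLemma g (q₂ * q₂) pp p∣gq₂²
  ... | inj₁ p∣g = squarefree p pp (∣m⇒∣m*n q₂ (subst (p * p ∣_) (sym q₁≡q₁/g*g) (*-pres-∣ p∣q₁/g p∣g)))
    where
    q₁≡q₁/g*g : q₁ ≡ (q₁ div g) * g
    q₁≡q₁/g*g = m∣n⇒n≡n-div-m*m g∣q₁ (∣-pos⇒pos q₁≥1 g∣q₁)
  ... | inj₂ p∣q₂² = squarefree p pp (*-pres-∣ (∣-trans p∣q₁/g (div-∣ q₁≥1 g∣q₁)) (reduce (euclidsLemma q₂ q₂ pp p∣q₂²)))

module GramSums (N a′ q′ q₁ q₂ : ℕ) (q₁≥1 : 1 ≤ q₁) (q₂≥1 : 1 ≤ q₂)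
                (squarefree : ∀ p → Prime p → ¬ p * p ∣ q₁ * q₂) where

  q : ℕ
  q = qq N a′ q′ q₁ q₂

  private
    M₁ M₂ : ℕ
    M₁ = m₁ N a′ q′ q₁ q₂
    M₂ = m₂ N a′ q′ q₁ q₂

    g∣q₁ : gcd q₁ q′ ∣ q₁
    g∣q₁ = gcd[m,n]∣m q₁ q′

    g≥1 : 1 ≤ gcd q₁ q′
    g≥1 = ∣-pos⇒pos q₁≥1 g∣q₁

    M₁≥1 : 1 ≤ M₁
    M₁≥1 = div-pos q₁≥1 g∣q₁

    M₂≥1 : 1 ≤ M₂
    M₂≥1 = ℕP.*-mono-≤ g≥1 (ℕP.*-mono-≤ q₂≥1 q₂≥1)

    q≡M₁*M₂ : q ≡ M₁ * M₂
    q≡M₁*M₂ = trans (cong (_* (q₂ * q₂)) (m∣n⇒n≡n-div-m*m g∣q₁ g≥1)) (ℕP.*-assoc M₁ (gcd q₁ q′) (q₂ * q₂))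

    coprime : Coprime M₁ M₂
    coprime = coprime-quotient-square q₁≥1 squarefree g∣q₁

    crt : ∃ λ t → + M₁ ∣ℤ 0ℤ -ℤ t × + M₂ ∣ℤ t -ℤ + a′
    crt = chinese-remainder M₁ M₂ 0ℤ (+ a′) (subst (_∣ ∣ 0ℤ -ℤ + a′ ∣) (sym (coprime⇒gcd≡1 coprime)) (1∣ _))

    t : ℤ
    t = proj₁ crt

  q≥1 : 1 ≤ q
  q≥1 = subst (1 ≤_) (sym q≡M₁*M₂) (ℕP.*-mono-≤ M₁≥1 M₂≥1)

  θ ρ : ℤ → ℤ
  θ a = c q (+ N -ℤ a)
  ρ a = c M₁ a *ℤ c M₂ (a -ℤ + a′)

  private
    ρ≡translate : ∀ a → ρ a ≡ c q (a -ℤ t)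
    ρ≡translate a = begin
      c M₁ a *ℤ c M₂ (a -ℤ + a′)
        ≡⟨ cong₂ _*ℤ_
             (sym (c-congruent M₁ (a -ℤ t) a M₁≥1 (subst (+ M₁ ∣ℤ_) (sym (shift₁ a t)) (proj₁ (proj₂ crt)))))
             (c-congruent M₂ (a -ℤ + a′) (a -ℤ t) M₂≥1 (subst (+ M₂ ∣ℤ_) (sym (shift₂ a (+ a′) t)) (proj₂ (proj₂ crt)))) ⟩
      c M₁ (a -ℤ t) *ℤ c M₂ (a -ℤ t)
        ≡⟨ c-multiplicative M₁ M₂ (a -ℤ t) M₁≥1 M₂≥1 coprime ⟩
      c (M₁ * M₂) (a -ℤ t)
        ≡⟨ cong (λ r → c r (a -ℤ t)) (sym q≡M₁*M₂) ⟩
      c q (a -ℤ t) ∎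
      where
      open ≡-Reasoning
      shift₁ : ∀ a t → (a -ℤ t) -ℤ a ≡ 0ℤ -ℤ t
      shift₁ = solve-∀
      shift₂ : ∀ a b t → (a -ℤ b) -ℤ (a -ℤ t) ≡ t -ℤ b
      shift₂ = solve-∀

    ∑c*c≡q*φ : ∀ x → ∑ q (λ n → c q (x -ℤ + n) *ℤ c q (+ n -ℤ x)) ≡ + q *ℤ + φ q
    ∑c*c≡q*φ x =
      trans (c-convolution q x x q≥1) (cong (+ q *ℤ_) (trans (cong (c q) (ℤP.+-inverseʳ x)) (c[r,0]≡φ q q≥1)))

  θ·θ : ∑ q (λ n → θ (+ n) *ℤ θ (+ n)) ≡ + q *ℤ + φ q
  θ·θ = trans (∑-cong q (λ n → cong (θ (+ n) *ℤ_) (c-∣∣ q (+ N -ℤ + n) (+ n -ℤ + N) (ℤP.∣i-j∣≡∣j-i∣ (+ N) (+ n)))))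
              (∑c*c≡q*φ (+ N))

  ρ·ρ : ∑ q (λ n → ρ (+ n) *ℤ ρ (+ n)) ≡ + q *ℤ + φ q
  ρ·ρ = trans (∑-cong q (λ n → trans (cong₂ _*ℤ_ (ρ≡translate (+ n)) (ρ≡translate (+ n)))
                                      (cong (_*ℤ c q (+ n -ℤ t)) (c-∣∣ q (+ n -ℤ t) (t -ℤ + n) (ℤP.∣i-j∣≡∣j-i∣ (+ n) t)))))
              (∑c*c≡q*φ t)

  θ·ρ : ∑ q (λ n → θ (+ n) *ℤ ρ (+ n)) ≡ + q *ℤ ρ (+ N)
  θ·ρ = trans (∑-cong q (λ n → cong (θ (+ n) *ℤ_) (ρ≡translate (+ n))))
              (trans (c-convolution q (+ N) t q≥1) (cong (+ q *ℤ_) (sym (ρ≡translate (+ N)))))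

lemma5p14 : (N a' q' q₁ q₂ : ℕ) → 1 ≤ N → 1 ≤ a' → 1 ≤ q' → gcd a' q' ≡ 1
    → 1 ≤ q₁ → 1 ≤ q₂ → μ (q₁ * q₂) *ℤ μ (q₁ * q₂) ≡ + 1
    → (normSq (qq N a' q' q₁ q₂) (η* N a' q' q₁ q₂)
    ≡ ½ *ℚ (ℤtoℚ (+ φ (qq N a' q' q₁ q₂)) + ℤtoℚ (c (m₁ N a' q' q₁ q₂) (+ N) *ℤ c (m₂ N a' q' q₁ q₂) (+ N -ℤ + a'))))
    × (normSq (qq N a' q' q₁ q₂) (κ* N a' q' q₁ q₂)
    ≡ ½ *ℚ (ℤtoℚ (+ φ (qq N a' q' q₁ q₂)) - ℤtoℚ (c (m₁ N a' q' q₁ q₂) (+ N) *ℤ c (m₂ N a' q' q₁ q₂) (+ N -ℤ + a'))))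
    × (herm (qq N a' q' q₁ q₂) (η* N a' q' q₁ q₂) (κ* N a' q' q₁ q₂) ≡ 0ℚ)
    × (herm (qq N a' q' q₁ q₂) (κ* N a' q' q₁ q₂) (η* N a' q' q₁ q₂) ≡ 0ℚ)
lemma5p14 N a' q' q₁ q₂ _ _ _ _ q₁≥1 q₂≥1 μ²≡1 =
  normSq-half-sum , normSq-half-difference , herm-half-sum-difference , herm-half-difference-sum
  where
  open GramSums N a' q' q₁ q₂ q₁≥1 q₂≥1 (μ²≡1⇒squarefree (q₁ * q₂) (ℕP.*-mono-≤ q₁≥1 q₂≥1) μ²≡1)
  open EqualNorms q q≥1 θ ρ (+ φ q) (ρ (+ N)) θ·θ ρ·ρ θ·ρ
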